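{- Let $D$ be the formal derivative with respect to the context-free grammar $z \rightarrow xyz,\ x \rightarrow xy,\ y \rightarrow xy$. For every integer $n\geq 1$, \[ D^n(z)=\sum_{k=1}^{n}\sum_{m=k}^{n} C(n,k,m)\,x^m y^{k+n-m} z, \] where $C(n,k,m)$ is the number of partitions of $[n]$ into $k$ lists having exactly $m$ ascents.
   Context: The formal derivative $D$ with respect to a grammar is the unique linear operator on polynomials in the letters that sends each letter to its image under the grammar's rule and satisfies the Leibniz rule $D(uv)=D(u)v+uD(v)$. A partition of $[n]=\{1,\ldots,n\}$ into lists is a set partition of $[n]$ in which the elements of each block are linearly ordered. The number of ascents of such a partition is computed as follows: write each list $\sigma_1\sigma_2\cdots\sigma_j$ as $0\sigma_1\sigma_2\cdots\sigma_j0$ and count the positions $i\in\{0,\ldots,j-1\}$ with $\sigma_i<\sigma_{i+1}$ (where $\sigma_0=0$); the number of ascents of the partition is the sum of these counts over all its lists (so each list contributes at least one ascent). -}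

module Defs where

open import Data.Nat using (ℕ; zero; suc; _+_; _*_; _∸_; _<?_; _≟_; _≤_)
open import Data.Bool using (Bool; true; false; if_then_else_; _∧_)
open import Data.List using (List; []; _∷_; map; concatMap; concat; length; foldr; upTo; filterᵇ)
open import Data.Nat.ListAction using (sum)
open import Data.Bool.ListAction using (all; any)
open import Relation.Nullary.Decidable using (⌊_⌋)

-- Polynomials in the commuting letters x, y, z with ℕ coefficients,
-- presented syntactically; their meaning is the coefficient function.

data Letter : Set where
  lx ly lz : Letter

data Poly : Set where
  var   : Letter → Poly
  const : ℕ → Poly
  _⊕_   : Poly → Poly → Poly
  _⊗_   : Poly → Poly → Poly

infixl 6 _⊕_
infixl 7 _⊗_

Σ≤ : ℕ → (ℕ → ℕ) → ℕ
Σ≤ n f = sum (map f (upTo (suc n)))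

isZero : ℕ → Bool
isZero zero    = true
isZero (suc _) = false

isOne : ℕ → Bool
isOne (suc zero) = true
isOne _          = false

ind : Bool → ℕ
ind true  = 1
ind false = 0

coeff : Poly → ℕ → ℕ → ℕ → ℕ
coeff (var lx)  a b c = ind (isOne a ∧ isZero b ∧ isZero c)
coeff (var ly)  a b c = ind (isZero a ∧ isOne b ∧ isZero c)
coeff (var lz)  a b c = ind (isZero a ∧ isZero b ∧ isOne c)
coeff (const k) a b c = k * ind (isZero a ∧ isZero b ∧ isZero c)
coeff (p ⊕ q)   a b c = coeff p a b c + coeff q a b c
coeff (p ⊗ q)   a b c =
  Σ≤ a λ i → Σ≤ b λ j → Σ≤ c λ l →
    coeff p i j l * coeff q (a ∸ i) (b ∸ j) (c ∸ l)

_≈ₚ_ : Poly → Poly → Set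
p ≈ₚ q = ∀ a b c → coeff p a b c ≡ coeff q a b c
  where open import Relation.Binary.PropositionalEquality using (_≡_)

x y z : Poly
x = var lx
y = var ly
z = var lz

rule : Letter → Poly
rule lx = x ⊗ y
rule ly = x ⊗ y
rule lz = x ⊗ y ⊗ z

D : Poly → Poly
D (var a)   = rule a
D (const _) = const 0
D (p ⊕ q)   = D p ⊕ D q
D (p ⊗ q)   = D p ⊗ q ⊕ p ⊗ D q

D^ : ℕ → Poly → Poly
D^ zero    p = p
D^ (suc n) p = D (D^ n p)

_^ₚ_ : Poly → ℕ → Poly
p ^ₚ zero  = const 1
p ^ₚ suc n = p ⊗ (p ^ₚ n)

ΣP : ℕ → ℕ → (ℕ → Poly) → Poly
ΣP lo hi f = foldr _⊕_ (const 0) (map (λ i → f (lo + i)) (upTo (suc hi ∸ lo)))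

-- A set partition of [n] into lists is represented canonically as a list
-- of its blocks (each block a nonempty list, ordered internally), the
-- blocks arranged by increasing minimum element.

words : ℕ → ℕ → List (List ℕ)
words n zero      = [] ∷ []
words n (suc len) = concatMap (λ w → map (λ i → suc i ∷ w) (upTo n)) (words n len)

cuts : List ℕ → List (List (List ℕ))
cuts []       = [] ∷ []
cuts (a ∷ []) = ((a ∷ []) ∷ []) ∷ []
cuts (a ∷ b ∷ w) = concatMap ext (cuts (b ∷ w))
  where
  ext : List (List ℕ) → List (List (List ℕ))
  ext []         = []
  ext (bl ∷ bls) = ((a ∷ []) ∷ bl ∷ bls) ∷ ((a ∷ bl) ∷ bls) ∷ []

memᵇ : ℕ → List ℕ → Bool
memᵇ i w = any (λ j → ⌊ i ≟ j ⌋) w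

minL : List ℕ → ℕ
minL []          = 0
minL (a ∷ [])    = a
minL (a ∷ b ∷ w) with minL (b ∷ w)
... | m = if ⌊ a <? m ⌋ then a else m

increasing : List ℕ → Bool
increasing []          = true
increasing (a ∷ [])    = true
increasing (a ∷ b ∷ w) = ⌊ a <? b ⌋ ∧ increasing (b ∷ w)

-- a list of lists is a (canonical) partition of [n] into lists:
-- its concatenation has length n and contains each of 1..n
-- (hence is a permutation of [n]), and block minima increase
isListPartition : ℕ → List (List ℕ) → Bool
isListPartition n bls =
  ⌊ length (concat bls) ≟ n ⌋
  ∧ all (λ i → memᵇ (suc i) (concat bls)) (upTo n)
  ∧ increasing (map minL bls)

listPartitions : ℕ → List (List (List ℕ))
listPartitions n = filterᵇ (isListPartition n) (concatMap cuts (words n n))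

-- ascents of a list σ₁…σⱼ: positions i ∈ {0..j-1} with σᵢ < σᵢ₊₁, σ₀ = 0
ascFrom : ℕ → List ℕ → ℕ
ascFrom p []      = 0
ascFrom p (s ∷ r) = ind ⌊ p <? s ⌋ + ascFrom s r

ascList : List ℕ → ℕ
ascList = ascFrom 0

asc : List (List ℕ) → ℕ
asc bls = sum (map ascList bls)

C : ℕ → ℕ → ℕ → ℕ
C n k m = length (filterᵇ (λ bls → ⌊ length bls ≟ k ⌋ ∧ ⌊ asc bls ≟ m ⌋) (listPartitions n))

-- On coefficient functions ℕ³ → ℕ, multiplication of polynomials
-- becomes a triple convolution and D becomes δ = ↑ʸ θˣ + ↑ˣ θʸ + ↑ˣ ↑ʸ θᶻ, with θ the Euler
-- operators (x ∂/∂x, …) and ↑ the shifts (multiplication by x, …).  Each θ obeys the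
-- Leibniz rule and the shifts commute with convolution, so δ is a derivation; rotating the
-- coordinates reduces this to the variable x.  On monomials,
--   δ (xᵐ yᵉ z) = m xᵐ yᵉ⁺¹ z + e xᵐ⁺¹ yᵉ z + xᵐ⁺¹ yᵉ⁺¹ z,
-- which is how inserting n + 1 into a partition of [n] into k lists with m ascents
-- changes (m, k): m of the n + k places inside a list keep m, the other n + k − m raise it,
-- and a new singleton list raises both.  So Dⁿ z sums x^asc(π) y^(|π| + n − asc(π)) z over
-- the partitions π obtained by repeated insertion, and these are all partitions of [n] into
-- lists, each exactly once.

module Submission where

open import Defs
open import Data.Nat using (ℕ; zero; suc; _+_; _*_; _∸_; _≤_; _<_; _≟_; _<?_; _≡ᵇ_; z≤n; s≤s; z<s; s<s)
open import Data.Nat.Properties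
open import Data.Nat.Tactic.RingSolver using (solve-∀)
open import Data.Nat.ListAction using (sum)
open import Data.Nat.ListAction.Properties using (sum-++; sum-↭)
open import Data.List
  using (List; []; _∷_; _++_; map; foldr; concat; concatMap; applyUpTo; upTo; length; drop; filterᵇ)
open import Data.List.Properties
  using (map-++; map-cong; length-++; concat-++; ++-assoc; ++-identityʳ; ++-conicalˡ; ++-conicalʳ;
         ∷-injective; ∷-injectiveˡ; ∷-injectiveʳ)
open import Data.List.Relation.Unary.Any as Any using (here; there)
open import Data.List.Relation.Unary.Any.Properties using (any⁺; any⁻)
open import Data.List.Relation.Unary.Unique.Propositional using (Unique; []; _∷_)
import Data.List.Relation.Unary.Unique.Propositional.Properties as Unique
open import Data.List.Membership.Propositional using (_∈_; _∉_; find; lose)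
open import Data.List.Membership.Propositional.Properties
  using (∈-++⁺ˡ; ∈-++⁺ʳ; ∈-++⁻; ∈-map⁺; ∈-map⁻; ∈-concatMap⁺; ∈-concatMap⁻; ∈-concat⁻′; ∈-∃++;
         ∈-upTo⁺; ∈-upTo⁻; ∈-filter⁺; ∈-filter⁻)
open import Data.List.Membership.Propositional.Properties.WithK using (unique∧set⇒bag)
open import Data.List.Relation.Binary.BagAndSetEquality using (∼bag⇒↭)
open import Data.List.Relation.Binary.Permutation.Propositional using (_↭_; ↭-refl; ↭-sym; ↭-trans; prep; swap)
open import Data.List.Relation.Binary.Permutation.Propositional.Properties
  using (↭-length; All-resp-↭; ∈-resp-↭; shift; ++⁺ˡ; ++⁺ʳ) renaming (map⁺ to ↭-map⁺)
open import Data.List.Relation.Unary.All as All using (All; []; _∷_)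
open import Data.List.Relation.Unary.All.Properties using (++⁺; ++⁻ˡ; ++⁻ʳ; concat⁻; map⁺; all⁺; all⁻)
open import Data.Product using (_×_; _,_; proj₁; proj₂; ∃)
open import Data.Sum using (inj₁; inj₂)
open import Function using (_∘_)
open import Relation.Binary.PropositionalEquality
open import Relation.Nullary using (Dec; yes; no; ¬_; contradiction)
open import Relation.Nullary.Decidable using (⌊_⌋; isYes≗does; dec-true; dec-false; toWitness; fromWitness)
open import Data.Bool using (Bool; true; false; T; _∧_; if_then_else_)
open import Data.Bool.ListAction using (all)
open import Data.Bool.Properties using (T?; T-∧)
open import Data.Empty using (⊥)
open import Function.Bundles using (Equivalence; _⇔_; mk⇔)
open ≡-Reasoning

+-interchange : ∀ a b c d → (a + b) + (c + d) ≡ (a + c) + (b + d)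
+-interchange = solve-∀

+-right-comm : ∀ a b c → a + b + c ≡ a + c + b
+-right-comm = solve-∀

*-left-comm : ∀ a b c → a * (b * c) ≡ b * (a * c)
*-left-comm = solve-∀

⌊⌋-yes : {A : Set} (a? : Dec A) → A → ⌊ a? ⌋ ≡ true
⌊⌋-yes a? a = trans (isYes≗does a?) (dec-true a? a)

⌊⌋-no : {A : Set} (a? : Dec A) → ¬ A → ⌊ a? ⌋ ≡ false
⌊⌋-no a? ¬a = trans (isYes≗does a?) (dec-false a? ¬a)

Σ< : ℕ → (ℕ → ℕ) → ℕ
Σ< zero    f = 0
Σ< (suc n) f = f 0 + Σ< n (λ i → f (suc i))

Σ<-cong : ∀ n {f g : ℕ → ℕ} → (∀ i → i < n → f i ≡ g i) → Σ< n f ≡ Σ< n g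
Σ<-cong zero    h = refl
Σ<-cong (suc n) h = cong₂ _+_ (h 0 z<s) (Σ<-cong n λ i i<n → h (suc i) (s<s i<n))

Σ<-cong′ : ∀ n {f g : ℕ → ℕ} → (∀ i → f i ≡ g i) → Σ< n f ≡ Σ< n g
Σ<-cong′ n h = Σ<-cong n (λ i _ → h i)

Σ<-zero : ∀ n {f : ℕ → ℕ} → (∀ i → i < n → f i ≡ 0) → Σ< n f ≡ 0
Σ<-zero zero    h = refl
Σ<-zero (suc n) h = cong₂ _+_ (h 0 z<s) (Σ<-zero n λ i i<n → h (suc i) (s<s i<n))

Σ<-+ : ∀ n (f g : ℕ → ℕ) → Σ< n (λ i → f i + g i) ≡ Σ< n f + Σ< n g
Σ<-+ zero    f g = refl
Σ<-+ (suc n) f g =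
  trans (cong (f 0 + g 0 +_) (Σ<-+ n _ _)) (+-interchange (f 0) (g 0) _ _)

Σ<-*ˡ : ∀ n k (f : ℕ → ℕ) → Σ< n (λ i → k * f i) ≡ k * Σ< n f
Σ<-*ˡ zero    k f = sym (*-zeroʳ k)
Σ<-*ˡ (suc n) k f = trans (cong (k * f 0 +_) (Σ<-*ˡ n k _)) (sym (*-distribˡ-+ k (f 0) _))

Σ<-last : ∀ n (f : ℕ → ℕ) → Σ< (suc n) f ≡ Σ< n f + f n
Σ<-last zero    f = +-identityʳ (f 0)
Σ<-last (suc n) f = trans (cong (f 0 +_) (Σ<-last n _)) (sym (+-assoc (f 0) _ _))

Σ<-single : ∀ n j (f : ℕ → ℕ) → j < n → (∀ i → i < n → i ≢ j → f i ≡ 0) → Σ< n f ≡ f j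
Σ<-single (suc n) zero f _ h =
  trans (cong (f 0 +_) (Σ<-zero n λ i i<n → h (suc i) (s<s i<n) λ ())) (+-identityʳ (f 0))
Σ<-single (suc n) (suc j) f (s<s j<n) h =
  trans (cong (_+ Σ< n (λ i → f (suc i))) (h 0 z<s λ ()))
        (Σ<-single n j (λ i → f (suc i)) j<n λ i i<n i≢j → h (suc i) (s<s i<n) (i≢j ∘ suc-injective))

Σ<-comm : ∀ m n (f : ℕ → ℕ → ℕ) → Σ< m (λ i → Σ< n (f i)) ≡ Σ< n (λ j → Σ< m (λ i → f i j))
Σ<-comm zero    n f = sym (Σ<-zero n λ _ _ → refl)
Σ<-comm (suc m) n f =
  trans (cong (Σ< n (f 0) +_) (Σ<-comm m n (λ i → f (suc i)))) (sym (Σ<-+ n (f 0) _))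

Σ<-complementary : ∀ n (g : ℕ → ℕ) →
  Σ< (suc n) (λ i → i * g i) + Σ< (suc n) (λ i → (n ∸ i) * g i) ≡ n * Σ< (suc n) g
Σ<-complementary n g = begin
  Σ< (suc n) (λ i → i * g i) + Σ< (suc n) (λ i → (n ∸ i) * g i)
    ≡⟨ Σ<-+ (suc n) (λ i → i * g i) (λ i → (n ∸ i) * g i) ⟨
  Σ< (suc n) (λ i → i * g i + (n ∸ i) * g i)
    ≡⟨ Σ<-cong (suc n) (λ i i≤n → trans (sym (*-distribʳ-+ (g i) i (n ∸ i)))
                                         (cong (_* g i) (m+[n∸m]≡n (≤-pred i≤n)))) ⟩
  Σ< (suc n) (λ i → n * g i)
    ≡⟨ Σ<-*ˡ (suc n) n g ⟩
  n * Σ< (suc n) g ∎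

Σₗ : {A : Set} → List A → (A → ℕ) → ℕ
Σₗ xs g = sum (map g xs)

Σₗ-applyUpTo : ∀ n (f g : ℕ → ℕ) → Σₗ (applyUpTo g n) f ≡ Σ< n (f ∘ g)
Σₗ-applyUpTo zero    f g = refl
Σₗ-applyUpTo (suc n) f g = cong (f (g 0) +_) (Σₗ-applyUpTo n f (g ∘ suc))

Σₗ-upTo : ∀ n (f : ℕ → ℕ) → Σₗ (upTo n) f ≡ Σ< n f
Σₗ-upTo n f = Σₗ-applyUpTo n f (λ i → i)

Σₗ-++ : {A : Set} (xs ys : List A) (g : A → ℕ) → Σₗ (xs ++ ys) g ≡ Σₗ xs g + Σₗ ys g
Σₗ-++ xs ys g = trans (cong sum (map-++ g xs ys)) (sum-++ (map g xs) (map g ys))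

Σₗ-map : {A B : Set} (f : A → B) (xs : List A) (g : B → ℕ) → Σₗ (map f xs) g ≡ Σₗ xs (g ∘ f)
Σₗ-map f []       g = refl
Σₗ-map f (x ∷ xs) g = cong (g (f x) +_) (Σₗ-map f xs g)

Σₗ-concatMap : {A B : Set} (f : A → List B) (xs : List A) (g : B → ℕ) →
  Σₗ (concatMap f xs) g ≡ Σₗ xs (λ x → Σₗ (f x) g)
Σₗ-concatMap f []       g = refl
Σₗ-concatMap f (x ∷ xs) g =
  trans (Σₗ-++ (f x) (concatMap f xs) g) (cong (Σₗ (f x) g +_) (Σₗ-concatMap f xs g))

Σₗ-cong : {A : Set} (xs : List A) {g h : A → ℕ} → All (λ x → g x ≡ h x) xs → Σₗ xs g ≡ Σₗ xs h
Σₗ-cong []       []       = refl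
Σₗ-cong (x ∷ xs) (e ∷ es) = cong₂ _+_ e (Σₗ-cong xs es)

Σₗ-cong′ : {A : Set} (xs : List A) {g h : A → ℕ} → (∀ x → g x ≡ h x) → Σₗ xs g ≡ Σₗ xs h
Σₗ-cong′ xs e = cong sum (map-cong e xs)

Σ<-Σₗ : {A : Set} → ∀ n (xs : List A) (h : ℕ → A → ℕ) →
  Σ< n (λ i → Σₗ xs (h i)) ≡ Σₗ xs (λ x → Σ< n (λ i → h i x))
Σ<-Σₗ n []       h = Σ<-zero n λ _ _ → refl
Σ<-Σₗ n (x ∷ xs) h =
  trans (Σ<-+ n (λ i → h i x) (λ i → Σₗ xs (h i))) (cong (Σ< n (λ i → h i x) +_) (Σ<-Σₗ n xs h))

Σₗ-*ʳ : {A : Set} (xs : List A) (g : A → ℕ) (k : ℕ) → Σₗ xs g * k ≡ Σₗ xs (λ x → g x * k)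
Σₗ-*ʳ []       g k = refl
Σₗ-*ʳ (x ∷ xs) g k = trans (*-distribʳ-+ k (g x) (Σₗ xs g)) (cong (g x * k +_) (Σₗ-*ʳ xs g k))

Σₗ-unique-⇔ : {A : Set} {xs ys : List A} → Unique xs → Unique ys → (∀ {x} → x ∈ xs ⇔ x ∈ ys) →
  (g : A → ℕ) → Σₗ xs g ≡ Σₗ ys g
Σₗ-unique-⇔ uxs uys same g = sum-↭ (↭-map⁺ g (∼bag⇒↭ (unique∧set⇒bag uxs uys same)))

length-filterᵇ : {A : Set} (p : A → Bool) (xs : List A) → length (filterᵇ p xs) ≡ Σₗ xs (ind ∘ p)
length-filterᵇ p []       = refl
length-filterᵇ p (x ∷ xs) with p x
... | true  = cong suc (length-filterᵇ p xs)
... | false = length-filterᵇ p xs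

𝟙[_≡_] : ℕ → ℕ → ℕ
𝟙[ u ≡ v ] = ind (u ≡ᵇ v)

𝟙-refl : ∀ u → 𝟙[ u ≡ u ] ≡ 1
𝟙-refl zero    = refl
𝟙-refl (suc u) = 𝟙-refl u

𝟙-≢ : ∀ {u v} → u ≢ v → 𝟙[ u ≡ v ] ≡ 0
𝟙-≢ {zero}  {zero}  u≢v = contradiction refl u≢v
𝟙-≢ {zero}  {suc v} u≢v = refl
𝟙-≢ {suc u} {zero}  u≢v = refl
𝟙-≢ {suc u} {suc v} u≢v = 𝟙-≢ (u≢v ∘ cong suc)

∸-suc-< : ∀ k {m n} → suc k ≤ m → m ≤ n → m ∸ suc k < n ∸ k
∸-suc-< zero    (s≤s _)   m≤n       = m≤n
∸-suc-< (suc k) (s≤s k<m) (s≤s m≤n) = ∸-suc-< k k<m m≤n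

Σ<-triangle-single : ∀ n (h : ℕ → ℕ → ℕ) {k m} → 1 ≤ k → k ≤ m → m ≤ n →
  Σ< n (λ i → Σ< (n ∸ i) λ j → 𝟙[ k ≡ suc i ] * 𝟙[ m ≡ suc i + j ] * h (suc i) (suc i + j)) ≡ h k m
Σ<-triangle-single n h {suc k} {m} _ k<m m≤n = begin
  Σ< n (λ i → Σ< (n ∸ i) (G i))
    ≡⟨ Σ<-single n k (λ i → Σ< (n ∸ i) (G i)) (≤-trans k<m m≤n) (λ i _ i≢k →
         Σ<-zero (n ∸ i) λ j _ →
           cong (λ t → t * 𝟙[ m ≡ suc i + j ] * h (suc i) (suc i + j)) (𝟙-≢ (i≢k ∘ sym))) ⟩
  Σ< (n ∸ k) (G k)
    ≡⟨ Σ<-single (n ∸ k) (m ∸ suc k) (G k) (∸-suc-< k k<m m≤n) (λ j _ j≢ →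
         trans (cong (λ t → 𝟙[ k ≡ k ] * t * h (suc k) (suc k + j))
                     (𝟙-≢ {m} {suc k + j} λ e →
                        j≢ (trans (sym (m+n∸m≡n (suc k) j)) (cong (_∸ suc k) (sym e)))))
               (cong (_* h (suc k) (suc k + j)) (*-zeroʳ 𝟙[ k ≡ k ]))) ⟩
  G k (m ∸ suc k)
    ≡⟨ cong (λ t → 𝟙[ k ≡ k ] * 𝟙[ m ≡ t ] * h (suc k) t) (m+[n∸m]≡n k<m) ⟩
  𝟙[ k ≡ k ] * 𝟙[ m ≡ m ] * h (suc k) m
    ≡⟨ cong₂ (λ u v → u * v * h (suc k) m) (𝟙-refl k) (𝟙-refl m) ⟩
  1 * 1 * h (suc k) m
    ≡⟨ *-identityˡ (h (suc k) m) ⟩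
  h (suc k) m ∎
  where
  G : ℕ → ℕ → ℕ
  G i j = 𝟙[ suc k ≡ suc i ] * 𝟙[ m ≡ suc i + j ] * h (suc i) (suc i + j)

Coeffs : Set
Coeffs = ℕ → ℕ → ℕ → ℕ

infix 4 _≗₃_
_≗₃_ : Coeffs → Coeffs → Set
P ≗₃ Q = ∀ a b c → P a b c ≡ Q a b c

≗₃-refl : {P : Coeffs} → P ≗₃ P
≗₃-refl _ _ _ = refl

≗₃-sym : {P Q : Coeffs} → P ≗₃ Q → Q ≗₃ P
≗₃-sym e a b c = sym (e a b c)

infixr 4 _∙_
_∙_ : {P Q R : Coeffs} → P ≗₃ Q → Q ≗₃ R → P ≗₃ R
(e ∙ f) a b c = trans (e a b c) (f a b c)

infixl 6 _+₃_
_+₃_ : Coeffs → Coeffs → Coeffs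
(P +₃ Q) a b c = P a b c + Q a b c

infixr 8 _·₃_
_·₃_ : ℕ → Coeffs → Coeffs
(k ·₃ P) a b c = k * P a b c

+₃-cong : {P P′ Q Q′ : Coeffs} → P ≗₃ P′ → Q ≗₃ Q′ → P +₃ Q ≗₃ P′ +₃ Q′
+₃-cong e f a b c = cong₂ _+_ (e a b c) (f a b c)

·₃-cong : ∀ k {P Q} → P ≗₃ Q → k ·₃ P ≗₃ k ·₃ Q
·₃-cong k e a b c = cong (k *_) (e a b c)

Σ□ : ℕ → ℕ → ℕ → (ℕ → ℕ → ℕ → ℕ) → ℕ
Σ□ a b c h = Σ< (suc a) λ i → Σ< (suc b) λ j → Σ< (suc c) λ l → h i j l

Σ□-cong : ∀ a b c {h h′ : ℕ → ℕ → ℕ → ℕ} →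
  (∀ i j l → h i j l ≡ h′ i j l) → Σ□ a b c h ≡ Σ□ a b c h′
Σ□-cong a b c e = Σ<-cong′ (suc a) λ i → Σ<-cong′ (suc b) λ j → Σ<-cong′ (suc c) (e i j)

Σ□-+ : ∀ a b c (h h′ : ℕ → ℕ → ℕ → ℕ) →
  Σ□ a b c (λ i j l → h i j l + h′ i j l) ≡ Σ□ a b c h + Σ□ a b c h′
Σ□-+ a b c h h′ =
  trans (Σ<-cong′ (suc a) λ i →
           trans (Σ<-cong′ (suc b) λ j → Σ<-+ (suc c) (h i j) (h′ i j))
                 (Σ<-+ (suc b) (λ j → Σ< (suc c) (h i j)) (λ j → Σ< (suc c) (h′ i j))))
        (Σ<-+ (suc a) (λ i → Σ< (suc b) λ j → Σ< (suc c) (h i j))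
                      (λ i → Σ< (suc b) λ j → Σ< (suc c) (h′ i j)))

Σ□-weight : ∀ a b c (w : ℕ → ℕ) (h : ℕ → ℕ → ℕ → ℕ) →
  Σ□ a b c (λ i j l → w i * h i j l) ≡ Σ< (suc a) (λ i → w i * Σ< (suc b) λ j → Σ< (suc c) (h i j))
Σ□-weight a b c w h = Σ<-cong′ (suc a) λ i →
  trans (Σ<-cong′ (suc b) λ j → Σ<-*ˡ (suc c) (w i) (h i j)) (Σ<-*ˡ (suc b) (w i) λ j → Σ< (suc c) (h i j))

Σ□-*ˡ : ∀ a b c k (h : ℕ → ℕ → ℕ → ℕ) → Σ□ a b c (λ i j l → k * h i j l) ≡ k * Σ□ a b c h
Σ□-*ˡ a b c k h =
  trans (Σ□-weight a b c (λ _ → k) h) (Σ<-*ˡ (suc a) k λ i → Σ< (suc b) λ j → Σ< (suc c) (h i j))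

infixl 7 _∗_
_∗_ : Coeffs → Coeffs → Coeffs
(P ∗ Q) a b c = Σ□ a b c λ i j l → P i j l * Q (a ∸ i) (b ∸ j) (c ∸ l)

coeff-⊗ : ∀ p q → coeff (p ⊗ q) ≗₃ coeff p ∗ coeff q
coeff-⊗ p q a b c = trans (Σₗ-upTo (suc a) f₁) (Σ<-cong′ (suc a) λ i →
  trans (Σₗ-upTo (suc b) (f₂ i)) (Σ<-cong′ (suc b) λ j → Σₗ-upTo (suc c) (f₃ i j)))
  where
  f₃ : ℕ → ℕ → ℕ → ℕ
  f₃ i j l = coeff p i j l * coeff q (a ∸ i) (b ∸ j) (c ∸ l)
  f₂ : ℕ → ℕ → ℕ
  f₂ i j = Σ≤ c (f₃ i j)
  f₁ : ℕ → ℕ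
  f₁ i = Σ≤ b (f₂ i)

∗-cong : {P P′ Q Q′ : Coeffs} → P ≗₃ P′ → Q ≗₃ Q′ → P ∗ Q ≗₃ P′ ∗ Q′
∗-cong e f a b c = Σ□-cong a b c λ i j l → cong₂ _*_ (e i j l) (f (a ∸ i) (b ∸ j) (c ∸ l))

∗-distribʳ-+₃ : ∀ P P′ Q → (P +₃ P′) ∗ Q ≗₃ P ∗ Q +₃ P′ ∗ Q
∗-distribʳ-+₃ P P′ Q a b c = trans
  (Σ□-cong a b c λ i j l → *-distribʳ-+ (Q (a ∸ i) (b ∸ j) (c ∸ l)) (P i j l) (P′ i j l))
  (Σ□-+ a b c (λ i j l → P i j l * Q (a ∸ i) (b ∸ j) (c ∸ l))
              (λ i j l → P′ i j l * Q (a ∸ i) (b ∸ j) (c ∸ l)))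

∗-distribˡ-+₃ : ∀ P Q Q′ → P ∗ (Q +₃ Q′) ≗₃ P ∗ Q +₃ P ∗ Q′
∗-distribˡ-+₃ P Q Q′ a b c = trans
  (Σ□-cong a b c λ i j l → *-distribˡ-+ (P i j l) (Q (a ∸ i) (b ∸ j) (c ∸ l)) (Q′ (a ∸ i) (b ∸ j) (c ∸ l)))
  (Σ□-+ a b c (λ i j l → P i j l * Q (a ∸ i) (b ∸ j) (c ∸ l))
              (λ i j l → P i j l * Q′ (a ∸ i) (b ∸ j) (c ∸ l)))

·₃-∗ : ∀ k P Q → (k ·₃ P) ∗ Q ≗₃ k ·₃ (P ∗ Q)
·₃-∗ k P Q a b c = trans (Σ□-cong a b c λ i j l → *-assoc k (P i j l) (Q (a ∸ i) (b ∸ j) (c ∸ l)))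
                         (Σ□-*ˡ a b c k λ i j l → P i j l * Q (a ∸ i) (b ∸ j) (c ∸ l))

-- Rotating the coordinates transports statements about the first variable to the other two.

rot : Coeffs → Coeffs
rot P a b c = P b c a

rot-cong : {P Q : Coeffs} → P ≗₃ Q → rot P ≗₃ rot Q
rot-cong e a b c = e b c a

rot-∗ : ∀ P Q → rot (P ∗ Q) ≗₃ rot P ∗ rot Q
rot-∗ P Q a b c =
  trans (Σ<-cong′ (suc b) λ i → Σ<-comm (suc c) (suc a) λ j l → P i j l * Q (b ∸ i) (c ∸ j) (a ∸ l))
        (Σ<-comm (suc b) (suc a) λ i l → Σ< (suc c) λ j → P i j l * Q (b ∸ i) (c ∸ j) (a ∸ l))

rot²-∗ : ∀ P Q → rot (rot (P ∗ Q)) ≗₃ rot (rot P) ∗ rot (rot Q)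
rot²-∗ P Q = rot-cong (rot-∗ P Q) ∙ rot-∗ (rot P) (rot Q)

-- Since rot ∘ rot is the inverse of rot, O ᴿ acts on the second variable as O acts on the first.
infix 9 _ᴿ
_ᴿ : (Coeffs → Coeffs) → Coeffs → Coeffs
(O ᴿ) P = rot (O (rot (rot P)))

record IsLinear (O : Coeffs → Coeffs) : Set where
  field
    ≗-cong : ∀ {P Q} → P ≗₃ Q → O P ≗₃ O Q
    +-hom  : ∀ P Q → O (P +₃ Q) ≗₃ O P +₃ O Q
    ·-hom  : ∀ k P → O (k ·₃ P) ≗₃ k ·₃ O P

record IsShift (S : Coeffs → Coeffs) : Set where
  field
    linear  : IsLinear S
    ∗-pullˡ : ∀ P Q → S (P ∗ Q) ≗₃ S P ∗ Q
    ∗-pullʳ : ∀ P Q → S (P ∗ Q) ≗₃ P ∗ S Q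

record IsDerivation (O : Coeffs → Coeffs) : Set where
  field
    linear  : IsLinear O
    leibniz : ∀ P Q → O (P ∗ Q) ≗₃ O P ∗ Q +₃ P ∗ O Q

ᴿ-linear : ∀ {O} → IsLinear O → IsLinear (O ᴿ)
ᴿ-linear l = record
  { ≗-cong = λ e → rot-cong (≗-cong λ a b c → e c a b)
  ; +-hom  = λ P Q → rot-cong (+-hom (rot (rot P)) (rot (rot Q)))
  ; ·-hom  = λ k P → rot-cong (·-hom k (rot (rot P)))
  }
  where open IsLinear l

∘-linear : ∀ {O O′} → IsLinear O → IsLinear O′ → IsLinear (O ∘ O′)
∘-linear {O′ = O′} l l′ = record
  { ≗-cong = L.≗-cong ∘ L′.≗-cong
  ; +-hom  = λ P Q → L.≗-cong (L′.+-hom P Q) ∙ L.+-hom (O′ P) (O′ Q)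
  ; ·-hom  = λ k P → L.≗-cong (L′.·-hom k P) ∙ L.·-hom k (O′ P)
  }
  where
  module L  = IsLinear l
  module L′ = IsLinear l′

+-linear : ∀ {O O′} → IsLinear O → IsLinear O′ → IsLinear (λ P → O P +₃ O′ P)
+-linear {O} {O′} l l′ = record
  { ≗-cong = λ e → +₃-cong (L.≗-cong e) (L′.≗-cong e)
  ; +-hom  = λ P Q → +₃-cong (L.+-hom P Q) (L′.+-hom P Q)
                   ∙ λ a b c → +-interchange (O P a b c) (O Q a b c) (O′ P a b c) (O′ Q a b c)
  ; ·-hom  = λ k P → +₃-cong (L.·-hom k P) (L′.·-hom k P) ∙ λ _ _ _ → sym (*-distribˡ-+ k _ _)
  }
  where
  module L  = IsLinear l
  module L′ = IsLinear l′

ᴿ-shift : ∀ {S} → IsShift S → IsShift (S ᴿ)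
ᴿ-shift {S} s = record
  { linear  = ᴿ-linear linear
  ; ∗-pullˡ = λ P Q → rot-cong (≗-cong (rot²-∗ P Q) ∙ ∗-pullˡ (rot (rot P)) (rot (rot Q)))
                    ∙ rot-∗ (S (rot (rot P))) (rot (rot Q))
  ; ∗-pullʳ = λ P Q → rot-cong (≗-cong (rot²-∗ P Q) ∙ ∗-pullʳ (rot (rot P)) (rot (rot Q)))
                    ∙ rot-∗ (rot (rot P)) (S (rot (rot Q)))
  }
  where
  open IsShift s
  open IsLinear linear

ᴿ-derivation : ∀ {O} → IsDerivation O → IsDerivation (O ᴿ)
ᴿ-derivation {O} d = record
  { linear  = ᴿ-linear linear
  ; leibniz = λ P Q → rot-cong (≗-cong (rot²-∗ P Q) ∙ leibniz (rot (rot P)) (rot (rot Q)))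
                    ∙ +₃-cong (rot-∗ (O (rot (rot P))) (rot (rot Q))) (rot-∗ (rot (rot P)) (O (rot (rot Q))))
  }
  where
  open IsDerivation d
  open IsLinear linear

shift∘derivation : ∀ {S O} → IsShift S → IsDerivation O → IsDerivation (S ∘ O)
shift∘derivation {O = O} s d = record
  { linear  = ∘-linear S.linear D.linear
  ; leibniz = λ P Q → L.≗-cong (D.leibniz P Q) ∙ L.+-hom (O P ∗ Q) (P ∗ O Q)
                    ∙ +₃-cong (S.∗-pullˡ (O P) Q) (S.∗-pullʳ P (O Q))
  }
  where
  module S = IsShift s
  module D = IsDerivation d
  module L = IsLinear S.linear

+-derivation : ∀ {O O′} → IsDerivation O → IsDerivation O′ → IsDerivation (λ P → O P +₃ O′ P)
+-derivation {O} {O′} d d′ = record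
  { linear  = +-linear D.linear D′.linear
  ; leibniz = λ P Q → +₃-cong (D.leibniz P Q) (D′.leibniz P Q)
                    ∙ (λ a b c → +-interchange ((O P ∗ Q) a b c) ((P ∗ O Q) a b c)
                                               ((O′ P ∗ Q) a b c) ((P ∗ O′ Q) a b c))
                    ∙ +₃-cong (≗₃-sym (∗-distribʳ-+₃ (O P) (O′ P) Q)) (≗₃-sym (∗-distribˡ-+₃ P (O Q) (O′ Q)))
  }
  where
  module D  = IsDerivation d
  module D′ = IsDerivation d′

θˣ : Coeffs → Coeffs
θˣ P a b c = a * P a b c

θʸ θᶻ : Coeffs → Coeffs
θʸ = θˣ ᴿ
θᶻ = θʸ ᴿ

θˣ-derivation : IsDerivation θˣ
θˣ-derivation = record
  { linear  = record
    { ≗-cong = λ e a b c → cong (a *_) (e a b c)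
    ; +-hom  = λ P Q a b c → *-distribˡ-+ a (P a b c) (Q a b c)
    ; ·-hom  = λ k P a b c → *-left-comm a k (P a b c)
    }
  ; leibniz = leibniz
  }
  where
  leibniz : ∀ P Q → θˣ (P ∗ Q) ≗₃ θˣ P ∗ Q +₃ P ∗ θˣ Q
  leibniz P Q a b c = sym (begin
    (θˣ P ∗ Q) a b c + (P ∗ θˣ Q) a b c
      ≡⟨ cong₂ _+_ (Σ□-cong a b c λ i j l → *-assoc i (P i j l) (Q (a ∸ i) (b ∸ j) (c ∸ l)))
                   (Σ□-cong a b c λ i j l → *-left-comm (P i j l) (a ∸ i) (Q (a ∸ i) (b ∸ j) (c ∸ l))) ⟩
    Σ□ a b c (λ i j l → i * h i j l) + Σ□ a b c (λ i j l → (a ∸ i) * h i j l)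
      ≡⟨ cong₂ _+_ (Σ□-weight a b c (λ i → i) h) (Σ□-weight a b c (a ∸_) h) ⟩
    Σ< (suc a) (λ i → i * g i) + Σ< (suc a) (λ i → (a ∸ i) * g i)
      ≡⟨ Σ<-complementary a g ⟩
    a * (P ∗ Q) a b c ∎)
    where
    h : ℕ → ℕ → ℕ → ℕ
    h i j l = P i j l * Q (a ∸ i) (b ∸ j) (c ∸ l)
    g : ℕ → ℕ
    g i = Σ< (suc b) λ j → Σ< (suc c) (h i j)

θʸ-derivation : IsDerivation θʸ
θʸ-derivation = ᴿ-derivation θˣ-derivation

θᶻ-derivation : IsDerivation θᶻ
θᶻ-derivation = ᴿ-derivation θʸ-derivation

↑ˣ : Coeffs → Coeffs
↑ˣ P zero    b c = 0
↑ˣ P (suc a) b c = P a b c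

↑ʸ ↑ᶻ : Coeffs → Coeffs
↑ʸ = ↑ˣ ᴿ
↑ᶻ = ↑ʸ ᴿ

↑ˣ-shift : IsShift ↑ˣ
↑ˣ-shift = record
  { linear  = record { ≗-cong = ≗-cong ; +-hom = +-hom ; ·-hom = ·-hom }
  ; ∗-pullˡ = ∗-pullˡ
  ; ∗-pullʳ = ∗-pullʳ
  }
  where
  ≗-cong : ∀ {P Q} → P ≗₃ Q → ↑ˣ P ≗₃ ↑ˣ Q
  ≗-cong e zero    b c = refl
  ≗-cong e (suc a) b c = e a b c

  +-hom : ∀ P Q → ↑ˣ (P +₃ Q) ≗₃ ↑ˣ P +₃ ↑ˣ Q
  +-hom P Q zero    b c = refl
  +-hom P Q (suc a) b c = refl

  ·-hom : ∀ k P → ↑ˣ (k ·₃ P) ≗₃ k ·₃ ↑ˣ P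
  ·-hom k P zero    b c = sym (*-zeroʳ k)
  ·-hom k P (suc a) b c = refl

  ∗-pullˡ : ∀ P Q → ↑ˣ (P ∗ Q) ≗₃ ↑ˣ P ∗ Q
  ∗-pullˡ P Q zero    b c =
    sym (trans (+-identityʳ _) (Σ<-zero (suc b) λ _ _ → Σ<-zero (suc c) λ _ _ → refl))
  ∗-pullˡ P Q (suc a) b c =
    sym (cong (_+ (P ∗ Q) a b c) (Σ<-zero (suc b) λ _ _ → Σ<-zero (suc c) λ _ _ → refl))

  ∗-pullʳ : ∀ P Q → ↑ˣ (P ∗ Q) ≗₃ P ∗ ↑ˣ Q
  ∗-pullʳ P Q zero    b c = sym (trans (+-identityʳ _)
    (Σ<-zero (suc b) λ j _ → Σ<-zero (suc c) λ l _ → *-zeroʳ (P 0 j l)))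
  ∗-pullʳ P Q (suc a) b c = sym (begin
    Σ< (suc (suc a)) f
      ≡⟨ Σ<-last (suc a) f ⟩
    Σ< (suc a) f + f (suc a)
      ≡⟨ cong₂ _+_
           (Σ<-cong (suc a) λ i i≤a → Σ<-cong′ (suc b) λ j → Σ<-cong′ (suc c) λ l →
              cong (λ t → P i j l * ↑ˣ Q t (b ∸ j) (c ∸ l)) (+-∸-assoc 1 (≤-pred i≤a)))
           (Σ<-zero (suc b) λ j _ → Σ<-zero (suc c) λ l _ →
              trans (cong (λ t → P (suc a) j l * ↑ˣ Q t (b ∸ j) (c ∸ l)) (n∸n≡0 a))
                    (*-zeroʳ (P (suc a) j l))) ⟩
    (P ∗ Q) a b c + 0
      ≡⟨ +-identityʳ _ ⟩
    (P ∗ Q) a b c ∎)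
    where
    f : ℕ → ℕ
    f i = Σ< (suc b) λ j → Σ< (suc c) λ l → P i j l * ↑ˣ Q (suc a ∸ i) (b ∸ j) (c ∸ l)

↑ʸ-shift : IsShift ↑ʸ
↑ʸ-shift = ᴿ-shift ↑ˣ-shift

↑ᶻ-shift : IsShift ↑ᶻ
↑ᶻ-shift = ᴿ-shift ↑ʸ-shift

-- The coefficient-level form of D = xy ∂/∂x + xy ∂/∂y + xyz ∂/∂z.
δ : Coeffs → Coeffs
δ P = ↑ʸ (θˣ P) +₃ ↑ˣ (θʸ P) +₃ ↑ˣ (↑ʸ (θᶻ P))

δ-derivation : IsDerivation δ
δ-derivation =
  +-derivation (+-derivation (shift∘derivation ↑ʸ-shift θˣ-derivation)
                             (shift∘derivation ↑ˣ-shift θʸ-derivation))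
               (shift∘derivation ↑ˣ-shift (shift∘derivation ↑ʸ-shift θᶻ-derivation))

open IsLinear (IsDerivation.linear δ-derivation)
  renaming (≗-cong to δ-cong; +-hom to δ-+; ·-hom to δ-·)

-- The empty sum is definitionally 0 ·₃ (λ _ _ _ → 0), so ·-hom covers it.
linear-Σₗ : ∀ {O} → IsLinear O → {A : Set} (xs : List A) (F : A → Coeffs) →
  O (λ a b c → Σₗ xs λ x → F x a b c) ≗₃ (λ a b c → Σₗ xs λ x → O (F x) a b c)
linear-Σₗ l []       F = IsLinear.·-hom l 0 (λ _ _ _ → 0)
linear-Σₗ l (x ∷ xs) F = IsLinear.+-hom l (F x) _ ∙ +₃-cong ≗₃-refl (linear-Σₗ l xs F)

monomial : ℕ → ℕ → ℕ → Coeffs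
monomial m e f a b c = 𝟙[ a ≡ m ] * 𝟙[ b ≡ e ] * 𝟙[ c ≡ f ]

coeff-const : ∀ k → coeff (const k) ≗₃ k ·₃ monomial 0 0 0
coeff-const k zero    zero    zero    = refl
coeff-const k zero    zero    (suc c) = refl
coeff-const k zero    (suc b) c       = refl
coeff-const k (suc a) b       c       = refl

coeff-x : coeff x ≗₃ monomial 1 0 0
coeff-x zero          b       c       = refl
coeff-x 1             zero    zero    = refl
coeff-x 1             zero    (suc c) = refl
coeff-x 1             (suc b) c       = refl
coeff-x (suc (suc a)) b       c       = refl

coeff-y : coeff y ≗₃ monomial 0 1 0
coeff-y zero    zero          c       = refl
coeff-y zero    1             zero    = refl
coeff-y zero    1             (suc c) = refl
coeff-y zero    (suc (suc b)) c       = refl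
coeff-y (suc a) b             c       = refl

coeff-z : coeff z ≗₃ monomial 0 0 1
coeff-z zero    zero    zero          = refl
coeff-z zero    zero    1             = refl
coeff-z zero    zero    (suc (suc c)) = refl
coeff-z zero    (suc b) c             = refl
coeff-z (suc a) b       c             = refl

∗-identityˡ : ∀ Q → monomial 0 0 0 ∗ Q ≗₃ Q
∗-identityˡ Q a b c = begin
  (1 * Q a b c + Σ< c (λ _ → 0)) + Σ< b (λ _ → Σ< (suc c) λ _ → 0)
    + Σ< a (λ _ → Σ< (suc b) λ _ → Σ< (suc c) λ _ → 0)
    ≡⟨ cong₂ _+_ (cong₂ _+_ (cong₂ _+_ (*-identityˡ (Q a b c)) (Σ<-zero c λ _ _ → refl))
                            (Σ<-zero b λ _ _ → Σ<-zero (suc c) λ _ _ → refl))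
                 (Σ<-zero a λ _ _ → Σ<-zero (suc b) λ _ _ → Σ<-zero (suc c) λ _ _ → refl) ⟩
  Q a b c + 0 + 0 + 0
    ≡⟨ trans (+-identityʳ _) (trans (+-identityʳ _) (+-identityʳ _)) ⟩
  Q a b c ∎

↑ˣ-monomial : ∀ m e f → ↑ˣ (monomial m e f) ≗₃ monomial (suc m) e f
↑ˣ-monomial m e f zero    b c = refl
↑ˣ-monomial m e f (suc a) b c = refl

↑ʸ-monomial : ∀ m e f → ↑ʸ (monomial m e f) ≗₃ monomial m (suc e) f
↑ʸ-monomial m e f a zero    c = sym (cong (_* 𝟙[ c ≡ f ]) (*-zeroʳ 𝟙[ a ≡ m ]))
↑ʸ-monomial m e f a (suc b) c = refl

↑ᶻ-monomial : ∀ m e f → ↑ᶻ (monomial m e f) ≗₃ monomial m e (suc f)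
↑ᶻ-monomial m e f a b zero    = sym (*-zeroʳ (𝟙[ a ≡ m ] * 𝟙[ b ≡ e ]))
↑ᶻ-monomial m e f a b (suc c) = refl

shift-∗ˡ : ∀ {S} → IsShift S → ∀ {P P′} Q → S P ≗₃ P′ → P′ ∗ Q ≗₃ S (P ∗ Q)
shift-∗ˡ s {P} Q e = ∗-cong (≗₃-sym e) ≗₃-refl ∙ ≗₃-sym (IsShift.∗-pullˡ s P Q)

monomial-∗ : ∀ m e f m′ e′ f′ →
  monomial m e f ∗ monomial m′ e′ f′ ≗₃ monomial (m + m′) (e + e′) (f + f′)
monomial-∗ (suc m) e f m′ e′ f′ =
  shift-∗ˡ ↑ˣ-shift (monomial m′ e′ f′) (↑ˣ-monomial m e f)
  ∙ IsLinear.≗-cong (IsShift.linear ↑ˣ-shift) (monomial-∗ m e f m′ e′ f′)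
  ∙ ↑ˣ-monomial (m + m′) (e + e′) (f + f′)
monomial-∗ zero (suc e) f m′ e′ f′ =
  shift-∗ˡ ↑ʸ-shift (monomial m′ e′ f′) (↑ʸ-monomial 0 e f)
  ∙ IsLinear.≗-cong (IsShift.linear ↑ʸ-shift) (monomial-∗ 0 e f m′ e′ f′)
  ∙ ↑ʸ-monomial m′ (e + e′) (f + f′)
monomial-∗ zero zero (suc f) m′ e′ f′ =
  shift-∗ˡ ↑ᶻ-shift (monomial m′ e′ f′) (↑ᶻ-monomial 0 0 f)
  ∙ IsLinear.≗-cong (IsShift.linear ↑ᶻ-shift) (monomial-∗ 0 0 f m′ e′ f′)
  ∙ ↑ᶻ-monomial m′ e′ (f + f′)
monomial-∗ zero zero zero m′ e′ f′ = ∗-identityˡ (monomial m′ e′ f′)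

monomial-≡ : ∀ {m e f m′ e′ f′} → m ≡ m′ → e ≡ e′ → f ≡ f′ → monomial m e f ≗₃ monomial m′ e′ f′
monomial-≡ refl refl refl _ _ _ = refl

coeff-^ₚ : ∀ {p m e f} → coeff p ≗₃ monomial m e f →
  ∀ k → coeff (p ^ₚ k) ≗₃ monomial (k * m) (k * e) (k * f)
coeff-^ₚ hp zero = coeff-const 1 ∙ λ _ _ _ → *-identityˡ _
coeff-^ₚ {p} {m} {e} {f} hp (suc k) =
  coeff-⊗ p (p ^ₚ k) ∙ ∗-cong hp (coeff-^ₚ hp k) ∙ monomial-∗ m e f (k * m) (k * e) (k * f)

coeff-x^ : ∀ m → coeff (x ^ₚ m) ≗₃ monomial m 0 0
coeff-x^ m = coeff-^ₚ coeff-x m ∙ monomial-≡ (*-identityʳ m) (*-zeroʳ m) (*-zeroʳ m)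

coeff-y^ : ∀ e → coeff (y ^ₚ e) ≗₃ monomial 0 e 0
coeff-y^ e = coeff-^ₚ coeff-y e ∙ monomial-≡ (*-zeroʳ e) (*-identityʳ e) (*-zeroʳ e)

coeff-xy : coeff (x ⊗ y) ≗₃ monomial 1 1 0
coeff-xy = coeff-⊗ x y ∙ ∗-cong coeff-x coeff-y ∙ monomial-∗ 1 0 0 0 1 0

coeff-xyz : coeff (x ⊗ y ⊗ z) ≗₃ monomial 1 1 1
coeff-xyz = coeff-⊗ (x ⊗ y) z ∙ ∗-cong coeff-xy coeff-z ∙ monomial-∗ 1 1 0 0 0 1

coeff-term : ∀ K m e → coeff (const K ⊗ (x ^ₚ m) ⊗ (y ^ₚ e) ⊗ z) ≗₃ K ·₃ monomial m e 1
coeff-term K m e =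
  coeff-⊗ (const K ⊗ (x ^ₚ m) ⊗ (y ^ₚ e)) z
  ∙ ∗-cong (coeff-⊗ (const K ⊗ (x ^ₚ m)) (y ^ₚ e)
            ∙ ∗-cong (coeff-⊗ (const K) (x ^ₚ m) ∙ ∗-cong (coeff-const K) (coeff-x^ m)
                      ∙ ·₃-∗ K (monomial 0 0 0) (monomial m 0 0))
                     (coeff-y^ e)
            ∙ ·₃-∗ K (monomial 0 0 0 ∗ monomial m 0 0) (monomial 0 e 0))
           coeff-z
  ∙ ·₃-∗ K (monomial 0 0 0 ∗ monomial m 0 0 ∗ monomial 0 e 0) (monomial 0 0 1)
  ∙ ·₃-cong K (∗-cong (∗-cong (monomial-∗ 0 0 0 m 0 0) ≗₃-refl ∙ monomial-∗ m 0 0 0 e 0) ≗₃-refl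
               ∙ monomial-∗ (m + 0) e 0 0 0 1
               ∙ monomial-≡ (trans (+-identityʳ (m + 0)) (+-identityʳ m)) (+-identityʳ e) refl)

θˣ-monomial : ∀ m e f → θˣ (monomial m e f) ≗₃ m ·₃ monomial m e f
θˣ-monomial m e f a b c with a ≟ m
... | yes refl = refl
... | no a≢m rewrite 𝟙-≢ a≢m = trans (*-zeroʳ a) (sym (*-zeroʳ m))

θʸ-monomial : ∀ m e f → θʸ (monomial m e f) ≗₃ e ·₃ monomial m e f
θʸ-monomial m e f a b c with b ≟ e
... | yes refl = refl
... | no b≢e rewrite 𝟙-≢ b≢e | *-zeroʳ 𝟙[ a ≡ m ] = trans (*-zeroʳ b) (sym (*-zeroʳ e))

θᶻ-monomial : ∀ m e f → θᶻ (monomial m e f) ≗₃ f ·₃ monomial m e f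
θᶻ-monomial m e f a b c with c ≟ f
... | yes refl = refl
... | no c≢f rewrite 𝟙-≢ c≢f | *-zeroʳ (𝟙[ a ≡ m ] * 𝟙[ b ≡ e ]) = trans (*-zeroʳ c) (sym (*-zeroʳ f))

shift-scaled : ∀ {S} → IsShift S → ∀ {P M M′} k → P ≗₃ k ·₃ M → S M ≗₃ M′ → S P ≗₃ k ·₃ M′
shift-scaled s {M = M} k e e′ = L.≗-cong e ∙ L.·-hom k M ∙ ·₃-cong k e′
  where module L = IsLinear (IsShift.linear s)

δ-monomial : ∀ m e f → δ (monomial m e f) ≗₃
  m ·₃ monomial m (suc e) f +₃ e ·₃ monomial (suc m) e f +₃ f ·₃ monomial (suc m) (suc e) f
δ-monomial m e f = +₃-cong
  (+₃-cong (shift-scaled ↑ʸ-shift m (θˣ-monomial m e f) (↑ʸ-monomial m e f))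
           (shift-scaled ↑ˣ-shift e (θʸ-monomial m e f) (↑ˣ-monomial m e f)))
  (shift-scaled ↑ˣ-shift f (shift-scaled ↑ʸ-shift f (θᶻ-monomial m e f) (↑ʸ-monomial m e f))
                           (↑ˣ-monomial m (suc e) f))

δ-var : ∀ ℓ → δ (coeff (var ℓ)) ≗₃ coeff (rule ℓ)
δ-var lx = δ-cong coeff-x ∙ δ-monomial 1 0 0
         ∙ (λ _ _ _ → trans (+-identityʳ _) (trans (+-identityʳ _) (+-identityʳ _))) ∙ ≗₃-sym coeff-xy
δ-var ly = δ-cong coeff-y ∙ δ-monomial 0 1 0
         ∙ (λ _ _ _ → trans (+-identityʳ _) (+-identityʳ _)) ∙ ≗₃-sym coeff-xy
δ-var lz = δ-cong coeff-z ∙ δ-monomial 0 0 1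
         ∙ (λ _ _ _ → +-identityʳ _) ∙ ≗₃-sym coeff-xyz

coeff-D : ∀ p → coeff (D p) ≗₃ δ (coeff p)
coeff-D (var ℓ)   = ≗₃-sym (δ-var ℓ)
coeff-D (const k) = ≗₃-sym (δ-cong (coeff-const k) ∙ δ-· k (monomial 0 0 0)
                            ∙ ·₃-cong k (δ-monomial 0 0 0) ∙ λ _ _ _ → *-zeroʳ k)
coeff-D (p ⊕ q)   = +₃-cong (coeff-D p) (coeff-D q) ∙ ≗₃-sym (δ-+ (coeff p) (coeff q))
coeff-D (p ⊗ q)   =
  +₃-cong (coeff-⊗ (D p) q ∙ ∗-cong (coeff-D p) (≗₃-refl {coeff q}))
          (coeff-⊗ p (D q) ∙ ∗-cong (≗₃-refl {coeff p}) (coeff-D q))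
  ∙ ≗₃-sym (IsDerivation.leibniz δ-derivation (coeff p) (coeff q))
  ∙ ≗₃-sym (δ-cong (coeff-⊗ p q))

-- Growing partitions into lists by inserting their largest element

Blocks : Set
Blocks = List (List ℕ)

size : Blocks → ℕ
size bs = Σₗ bs length

insertions : ℕ → List ℕ → List (List ℕ)
insertions N []      = (N ∷ []) ∷ []
insertions N (a ∷ w) = (N ∷ a ∷ w) ∷ map (a ∷_) (insertions N w)

insertIntoBlock : ℕ → Blocks → List Blocks
insertIntoBlock N []       = []
insertIntoBlock N (B ∷ bs) = map (_∷ bs) (insertions N B) ++ map (B ∷_) (insertIntoBlock N bs)

extensions : ℕ → Blocks → List Blocks
extensions N bs = insertIntoBlock N bs ++ (bs ++ (N ∷ []) ∷ []) ∷ []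

-- A new singleton list goes last, as its minimum exceeds those of the other lists.
byInsertion : ℕ → List Blocks
byInsertion zero    = [] ∷ []
byInsertion (suc n) = concatMap (extensions (suc n)) (byInsertion n)

ind-step : ∀ β (g : ℕ → ℕ) A →
  g (suc A) + ind β * g (suc (ind β + A)) ≡ ind β * g (ind β + A) + g (suc (ind β + A))
ind-step true  g A = regroup (g (suc A)) (g (suc (suc A)))
  where
  regroup : ∀ u v → u + (v + 0) ≡ (u + 0) + v
  regroup = solve-∀
ind-step false g A = +-identityʳ (g (suc A))

-- Of the |w| + 1 places for a new maximum N, the ascFrom p w places inside an ascent keep
-- the number of ascents and the others raise it by one; stated without subtraction.
ascFrom-insertions : ∀ N p w → p < N → All (_< N) w → (g : ℕ → ℕ) →
  Σₗ (insertions N w) (g ∘ ascFrom p) + ascFrom p w * g (suc (ascFrom p w))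
  ≡ ascFrom p w * g (ascFrom p w) + suc (length w) * g (suc (ascFrom p w))
ascFrom-insertions N p [] p<N [] g =
  trans (cong (λ t → g (t + 0) + 0 + 0) (cong ind (⌊⌋-yes (p <? N) p<N))) (+-identityʳ (g 1 + 0))
ascFrom-insertions N p (a ∷ w) p<N (a<N ∷ w<N) g = +-cancelʳ-≡ (A * G) _ _ (begin
  g (ascFrom p (N ∷ a ∷ w)) + Σₗ (map (a ∷_) (insertions N w)) (g ∘ ascFrom p) + (d + A) * G + A * G
    ≡⟨ cong (λ t → t + (d + A) * G + A * G)
            (cong₂ _+_ (cong g new-ascent) (Σₗ-map (a ∷_) (insertions N w) (g ∘ ascFrom p))) ⟩
  g (suc A) + S + (d + A) * G + A * G
    ≡⟨ spread (g (suc A)) S d A G ⟩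
  (g (suc A) + d * G) + (S + A * G) + A * G
    ≡⟨ cong₂ (λ u v → u + v + A * G) (ind-step ⌊ p <? a ⌋ g A) IH ⟩
  (d * G₀ + G) + (A * G₀ + suc l * G) + A * G
    ≡⟨ collect d A G₀ G l ⟩
  (d + A) * G₀ + suc (suc l) * G + A * G ∎)
  where
  A = ascFrom a w
  d = ind ⌊ p <? a ⌋
  l = length w
  G₀ = g (d + A)
  G = g (suc (d + A))
  S = Σₗ (insertions N w) (λ w′ → g (d + ascFrom a w′))
  new-ascent : ascFrom p (N ∷ a ∷ w) ≡ suc A
  new-ascent = cong₂ (λ u v → u + (v + A)) (cong ind (⌊⌋-yes (p <? N) p<N))
                                           (cong ind (⌊⌋-no (N <? a) (<-asym a<N)))
  IH : S + A * G ≡ A * G₀ + suc l * G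
  IH = subst (λ t → S + A * g t ≡ A * G₀ + suc l * g t) (+-suc d A)
             (ascFrom-insertions N a w a<N w<N (λ t → g (d + t)))
  spread : ∀ u S d A G → u + S + (d + A) * G + A * G ≡ (u + d * G) + (S + A * G) + A * G
  spread = solve-∀
  collect : ∀ d A G₀ G l →
    (d * G₀ + G) + (A * G₀ + suc l * G) + A * G ≡ (d + A) * G₀ + suc (suc l) * G + A * G
  collect = solve-∀

asc-insertIntoBlock : ∀ N bs → 0 < N → All (All (_< N)) bs → (g : ℕ → ℕ) →
  Σₗ (insertIntoBlock N bs) (g ∘ asc) + asc bs * g (suc (asc bs))
  ≡ asc bs * g (asc bs) + (size bs + length bs) * g (suc (asc bs))
asc-insertIntoBlock N []       0<N []            g = refl
asc-insertIntoBlock N (B ∷ bs) 0<N (B<N ∷ bs<N) g = begin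
  Σₗ (map (_∷ bs) (insertions N B) ++ map (B ∷_) (insertIntoBlock N bs)) (g ∘ asc) + (α + β) * G₁
    ≡⟨ cong (_+ (α + β) * G₁)
            (trans (Σₗ-++ (map (_∷ bs) (insertions N B)) (map (B ∷_) (insertIntoBlock N bs)) (g ∘ asc))
                   (cong₂ _+_ (Σₗ-map (_∷ bs) (insertions N B) (g ∘ asc))
                              (Σₗ-map (B ∷_) (insertIntoBlock N bs) (g ∘ asc)))) ⟩
  (S₁ + S₂) + (α + β) * G₁
    ≡⟨ interleave S₁ S₂ α β G₁ ⟩
  (S₁ + α * G₁) + (S₂ + β * G₁)
    ≡⟨ cong₂ _+_ (ascFrom-insertions N 0 B 0<N B<N (λ t → g (t + β))) IH ⟩
  (α * G₀ + suc (length B) * G₁) + (β * G₀ + (size bs + length bs) * G₁)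
    ≡⟨ collect α β G₀ G₁ (length B) (size bs) (length bs) ⟩
  (α + β) * G₀ + (length B + size bs + suc (length bs)) * G₁ ∎
  where
  α = ascList B
  β = asc bs
  G₀ = g (α + β)
  G₁ = g (suc (α + β))
  S₁ = Σₗ (insertions N B) (λ B′ → g (ascList B′ + β))
  S₂ = Σₗ (insertIntoBlock N bs) (λ y → g (α + asc y))
  IH : S₂ + β * G₁ ≡ β * G₀ + (size bs + length bs) * G₁
  IH = subst (λ t → S₂ + β * g t ≡ β * G₀ + (size bs + length bs) * g t) (+-suc α β)
             (asc-insertIntoBlock N bs 0<N bs<N (λ t → g (α + t)))
  interleave : ∀ S₁ S₂ α β G → (S₁ + S₂) + (α + β) * G ≡ (S₁ + α * G) + (S₂ + β * G)
  interleave = solve-∀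
  collect : ∀ α β G₀ G₁ lB s l →
    (α * G₀ + suc lB * G₁) + (β * G₀ + (s + l) * G₁) ≡ (α + β) * G₀ + (lB + s + suc l) * G₁
  collect = solve-∀

length-insertIntoBlock : ∀ N bs → All (λ y → length y ≡ length bs) (insertIntoBlock N bs)
length-insertIntoBlock N []       = []
length-insertIntoBlock N (B ∷ bs) = ++⁺ (map⁺ (All.tabulate λ _ → refl))
                                        (map⁺ (All.map (cong suc) (length-insertIntoBlock N bs)))

asc-extensions : ∀ N bs → 0 < N → All (All (_< N)) bs → (g : ℕ → ℕ → ℕ) →
  Σₗ (extensions N bs) (λ y → g (asc y) (length y)) + asc bs * g (suc (asc bs)) (length bs)
  ≡ asc bs * g (asc bs) (length bs) + (size bs + length bs) * g (suc (asc bs)) (length bs)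
    + g (suc (asc bs)) (suc (length bs))
asc-extensions N bs 0<N bs<N g = begin
  Σₗ (insertIntoBlock N bs ++ new ∷ []) h + m * g (suc m) k
    ≡⟨ cong (_+ m * g (suc m) k) (Σₗ-++ (insertIntoBlock N bs) (new ∷ []) h) ⟩
  Σₗ (insertIntoBlock N bs) h + (h new + 0) + m * g (suc m) k
    ≡⟨ cong₂ (λ u v → u + v + m * g (suc m) k)
             (Σₗ-cong (insertIntoBlock N bs) (All.map (λ {y} → cong (g (asc y))) (length-insertIntoBlock N bs)))
             (trans (+-identityʳ (h new)) (cong₂ g asc-new length-new)) ⟩
  Σₗ (insertIntoBlock N bs) (λ y → g (asc y) k) + g (suc m) (suc k) + m * g (suc m) k
    ≡⟨ +-right-comm (Σₗ (insertIntoBlock N bs) (λ y → g (asc y) k)) _ _ ⟩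
  Σₗ (insertIntoBlock N bs) (λ y → g (asc y) k) + m * g (suc m) k + g (suc m) (suc k)
    ≡⟨ cong (_+ g (suc m) (suc k)) (asc-insertIntoBlock N bs 0<N bs<N (λ t → g t k)) ⟩
  m * g m k + (size bs + k) * g (suc m) k + g (suc m) (suc k) ∎
  where
  m = asc bs
  k = length bs
  new = bs ++ (N ∷ []) ∷ []
  h : Blocks → ℕ
  h y = g (asc y) (length y)
  asc-new : asc new ≡ suc m
  asc-new = trans (Σₗ-++ bs ((N ∷ []) ∷ []) ascList)
                  (trans (cong (λ t → m + (ind t + 0 + 0)) (⌊⌋-yes (0 <? N) 0<N)) (+-comm m 1))
  length-new : length new ≡ suc k
  length-new = trans (length-++ bs) (+-comm k 1)

NonEmpty : List ℕ → Set
NonEmpty B = 0 < length B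

InRange : ℕ → ℕ → Set
InRange n e = 0 < e × e ≤ n

-- A partition of [n] into lists, except that [n] need not be covered nor the lists be ordered.
Fits : ℕ → Blocks → Set
Fits n x = All NonEmpty x × All (InRange n) (concat x) × length (concat x) ≡ n

size≡length-concat : ∀ bs → size bs ≡ length (concat bs)
size≡length-concat []       = refl
size≡length-concat (B ∷ bs) = trans (cong (length B +_) (size≡length-concat bs)) (sym (length-++ B))

entries< : ∀ {n x} → Fits n x → All (All (_< suc n)) x
entries< (_ , entries , _) = All.map (All.map λ e → s≤s (proj₂ e)) (concat⁻ entries)

ascFrom≤length : ∀ p w → ascFrom p w ≤ length w
ascFrom≤length p []      = z≤n
ascFrom≤length p (s ∷ w) = +-mono-≤ (ind≤1 ⌊ p <? s ⌋) (ascFrom≤length s w)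
  where
  ind≤1 : ∀ β → ind β ≤ 1
  ind≤1 true  = s≤s z≤n
  ind≤1 false = z≤n

asc≤size : ∀ bs → asc bs ≤ size bs
asc≤size []       = z≤n
asc≤size (B ∷ bs) = +-mono-≤ (ascFrom≤length 0 B) (asc≤size bs)

size-fits : ∀ {n x} → Fits n x → size x ≡ n
size-fits {x = x} (_ , _ , length≡n) = trans (size≡length-concat x) length≡n

extensions-count : ∀ n x → Fits n x → (g : ℕ → ℕ → ℕ) →
  Σₗ (extensions (suc n) x) (λ y → g (asc y) (length y))
  ≡ asc x * g (asc x) (length x) + (length x + n ∸ asc x) * g (suc (asc x)) (length x)
    + g (suc (asc x)) (suc (length x))
extensions-count n x fits g = +-cancelʳ-≡ (m * G₁) _ _ (begin
  Σₗ (extensions (suc n) x) (λ y → g (asc y) (length y)) + m * G₁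
    ≡⟨ asc-extensions (suc n) x z<s (entries< fits) g ⟩
  m * G₀ + (size x + k) * G₁ + G₂
    ≡⟨ cong (λ t → m * G₀ + t * G₁ + G₂) (trans (+-comm (size x) k) (sym (m∸n+n≡m m≤k+n))) ⟩
  m * G₀ + (k + size x ∸ m + m) * G₁ + G₂
    ≡⟨ cong (λ t → m * G₀ + (k + t ∸ m + m) * G₁ + G₂) size≡n ⟩
  m * G₀ + (k + n ∸ m + m) * G₁ + G₂
    ≡⟨ split m G₀ (k + n ∸ m) G₁ G₂ ⟩
  m * G₀ + (k + n ∸ m) * G₁ + G₂ + m * G₁ ∎)
  where
  m = asc x
  k = length x
  G₀ = g m k
  G₁ = g (suc m) k
  G₂ = g (suc m) (suc k)
  size≡n : size x ≡ n
  size≡n = size-fits fits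
  m≤k+n : m ≤ k + size x
  m≤k+n = ≤-trans (asc≤size x) (m≤n+m (size x) k)
  split : ∀ m G₀ e G₁ G₂ → m * G₀ + (e + m) * G₁ + G₂ ≡ m * G₀ + e * G₁ + G₂ + m * G₁
  split = solve-∀

insertions-↭ : ∀ N w {B′} → B′ ∈ insertions N w → B′ ↭ N ∷ w
insertions-↭ N []      (here refl) = ↭-refl
insertions-↭ N (a ∷ w) (here refl) = ↭-refl
insertions-↭ N (a ∷ w) (there p) with ∈-map⁻ (a ∷_) p
... | B′ , q , refl = ↭-trans (prep a (insertions-↭ N w q)) (swap a N ↭-refl)

insertIntoBlock-↭ : ∀ N bs {y} → y ∈ insertIntoBlock N bs → concat y ↭ N ∷ concat bs
insertIntoBlock-↭ N (B ∷ bs) p with ∈-++⁻ (map (_∷ bs) (insertions N B)) p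
... | inj₁ q with ∈-map⁻ (_∷ bs) q
...   | B′ , r , refl = ++⁺ʳ (concat bs) (insertions-↭ N B r)
insertIntoBlock-↭ N (B ∷ bs) p | inj₂ q with ∈-map⁻ (B ∷_) q
...   | y′ , r , refl = ↭-trans (++⁺ˡ B (insertIntoBlock-↭ N bs r)) (shift N B (concat bs))

extensions-↭ : ∀ N bs {y} → y ∈ extensions N bs → concat y ↭ N ∷ concat bs
extensions-↭ N bs p with ∈-++⁻ (insertIntoBlock N bs) p
... | inj₁ q          = insertIntoBlock-↭ N bs q
... | inj₂ (here refl) =
  subst (_↭ N ∷ concat bs) (concat-++ bs ((N ∷ []) ∷ []))
        (subst (λ t → concat bs ++ N ∷ [] ↭ N ∷ t) (++-identityʳ (concat bs)) (shift N (concat bs) []))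

nonEmpty-insertions : ∀ N w → All NonEmpty (insertions N w)
nonEmpty-insertions N w = All.tabulate λ q → subst (0 <_) (sym (↭-length (insertions-↭ N w q))) z<s

nonEmpty-insertIntoBlock : ∀ N bs {y} → All NonEmpty bs → y ∈ insertIntoBlock N bs → All NonEmpty y
nonEmpty-insertIntoBlock N (B ∷ bs) (neB ∷ ne) p with ∈-++⁻ (map (_∷ bs) (insertions N B)) p
... | inj₁ q with ∈-map⁻ (_∷ bs) q
...   | B′ , r , refl = All.lookup (nonEmpty-insertions N B) r ∷ ne
nonEmpty-insertIntoBlock N (B ∷ bs) (neB ∷ ne) p | inj₂ q with ∈-map⁻ (B ∷_) q
...   | y′ , r , refl = neB ∷ nonEmpty-insertIntoBlock N bs ne r

nonEmpty-extensions : ∀ N bs {y} → All NonEmpty bs → y ∈ extensions N bs → All NonEmpty y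
nonEmpty-extensions N bs ne p with ∈-++⁻ (insertIntoBlock N bs) p
... | inj₁ q          = nonEmpty-insertIntoBlock N bs ne q
... | inj₂ (here refl) = ++⁺ ne (z<s ∷ [])

fits-extensions : ∀ n {x y} → Fits n x → y ∈ extensions (suc n) x → Fits (suc n) y
fits-extensions n {x} (ne , entries , length≡n) y∈ =
  nonEmpty-extensions (suc n) x ne y∈ ,
  All-resp-↭ (↭-sym perm) ((z<s , ≤-refl) ∷ All.map (λ e → proj₁ e , m≤n⇒m≤1+n (proj₂ e)) entries) ,
  trans (↭-length perm) (cong suc length≡n)
  where
  perm = extensions-↭ (suc n) x y∈

Covers : ℕ → List ℕ → Set
Covers n w = ∀ i → i < n → suc i ∈ w

IsListPartition : ℕ → Blocks → Set
IsListPartition n x = Fits n x × Covers n (concat x) × T (increasing (map minL x))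

memᵇ⇒∈ : ∀ i w → T (memᵇ i w) → i ∈ w
memᵇ⇒∈ i w t = Any.map toWitness (any⁻ (λ j → ⌊ i ≟ j ⌋) w t)

∈⇒memᵇ : ∀ {i w} → i ∈ w → T (memᵇ i w)
∈⇒memᵇ {i} p = any⁺ (λ j → ⌊ i ≟ j ⌋) (Any.map fromWitness p)

isListPartition⇒ : ∀ n x → T (isListPartition n x) → Covers n (concat x) × T (increasing (map minL x))
isListPartition⇒ n x t =
  (λ i i<n → memᵇ⇒∈ (suc i) (concat x) (All.lookup (all⁺ member (upTo n) covers) (∈-upTo⁺ i<n))) , inc
  where
  member : ℕ → Bool
  member i = memᵇ (suc i) (concat x)
  rest = proj₂ (Equivalence.to (T-∧ {⌊ length (concat x) ≟ n ⌋}) t)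
  covers = proj₁ (Equivalence.to (T-∧ {all member (upTo n)}) rest)
  inc    = proj₂ (Equivalence.to (T-∧ {all member (upTo n)}) rest)

⇒isListPartition : ∀ n x → length (concat x) ≡ n → Covers n (concat x) →
  T (increasing (map minL x)) → T (isListPartition n x)
⇒isListPartition n x length≡n covers inc = Equivalence.from (T-∧ {⌊ length (concat x) ≟ n ⌋})
  (fromWitness length≡n ,
   Equivalence.from (T-∧ {all member (upTo n)})
     (all⁻ member (All.tabulate λ i∈ → ∈⇒memᵇ (covers _ (∈-upTo⁻ i∈))) , inc))
  where
  member : ℕ → Bool
  member i = memᵇ (suc i) (concat x)

unique-concatMap : {A B : Set} (f : A → List B) (r : B → A) {xs : List A} → Unique xs →
  (∀ {x} → x ∈ xs → Unique (f x)) → (∀ {x y} → x ∈ xs → y ∈ f x → r y ≡ x) →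
  Unique (concatMap f xs)
unique-concatMap f r {[]}     _            _  _ = []
unique-concatMap f r {x ∷ xs} (x∉ ∷ uxs) uf rf = Unique.++⁺ (uf (here refl))
  (unique-concatMap f r uxs (uf ∘ there) (rf ∘ there)) disjoint
  where
  disjoint : ∀ {v} → v ∈ f x × v ∈ concatMap f xs → ⊥
  disjoint (p , q) with find (∈-concatMap⁻ f {xs = xs} q)
  ... | x′ , x′∈ , q′ = All.lookup x∉ x′∈ (trans (sym (rf (here refl) p)) (rf (there x′∈) q′))

∈-words⁺ : ∀ n len {w} → length w ≡ len → All (InRange n) w → w ∈ words n len
∈-words⁺ n zero      {[]}        refl []                 = here refl
∈-words⁺ n (suc len) {suc i ∷ w} refl ((_ , i<n) ∷ ents) =
  ∈-concatMap⁺ (λ w′ → map (λ i → suc i ∷ w′) (upTo n))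
    (lose (∈-words⁺ n len refl ents) (∈-map⁺ (λ i → suc i ∷ w) (∈-upTo⁺ i<n)))

∈-words⁻ : ∀ n len {w} → w ∈ words n len → length w ≡ len × All (InRange n) w
∈-words⁻ n zero      (here refl) = refl , []
∈-words⁻ n (suc len) p
  with find (∈-concatMap⁻ (λ w′ → map (λ i → suc i ∷ w′) (upTo n)) {xs = words n len} p)
... | w′ , w′∈ , q with ∈-map⁻ (λ i → suc i ∷ w′) q
... | i , i∈ , refl with ∈-words⁻ n len w′∈
... | l , ents = cong suc l , (z<s , ∈-upTo⁻ i∈) ∷ ents

words-unique : ∀ n len → Unique (words n len)
words-unique n zero      = [] ∷ []
words-unique n (suc len) =
  unique-concatMap (λ w′ → map (λ i → suc i ∷ w′) (upTo n)) (drop 1) (words-unique n len)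
    (λ _ → Unique.map⁺ (λ e → suc-injective (∷-injectiveˡ e)) (Unique.upTo⁺ n))
    (λ {w′} _ q → drop-prefix w′ q)
  where
  drop-prefix : ∀ w′ {v} → v ∈ map (λ i → suc i ∷ w′) (upTo n) → drop 1 v ≡ w′
  drop-prefix w′ q with ∈-map⁻ (λ i → suc i ∷ w′) q
  ... | _ , _ , refl = refl

∈-cuts⁻ : ∀ w {bls} → bls ∈ cuts w → concat bls ≡ w × All NonEmpty bls
∈-cuts⁻ []          (here refl) = refl , []
∈-cuts⁻ (a ∷ [])    (here refl) = refl , z<s ∷ []
∈-cuts⁻ (a ∷ b ∷ w) p with find (∈-concatMap⁻ _ {xs = cuts (b ∷ w)} p)
... | [] , _ , ()
... | bl ∷ bs , c∈ , here refl with ∈-cuts⁻ (b ∷ w) c∈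
...   | e , ne = cong (a ∷_) e , z<s ∷ ne
∈-cuts⁻ (a ∷ b ∷ w) p | bl ∷ bs , c∈ , there (here refl) with ∈-cuts⁻ (b ∷ w) c∈
...   | e , ne = cong (a ∷_) e , z<s ∷ All.tail ne

concat≡[] : ∀ bls → concat bls ≡ [] → All NonEmpty bls → bls ≡ []
concat≡[] []              _  _        = refl
concat≡[] ([] ∷ bls)      _  (() ∷ _)
concat≡[] ((e ∷ B) ∷ bls) () _

∈-cuts⁺ : ∀ w bls → concat bls ≡ w → All NonEmpty bls → bls ∈ cuts w
∈-cuts⁺ [] bls e ne rewrite concat≡[] bls e ne = here refl
∈-cuts⁺ (a ∷ []) ((x ∷ B) ∷ bls) e (_ ∷ ne) with ∷-injective e
... | refl , e′ with ++-conicalˡ B (concat bls) e′ | concat≡[] bls (++-conicalʳ B (concat bls) e′) ne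
... | refl | refl = here refl
∈-cuts⁺ (a ∷ b ∷ w) ((x ∷ []) ∷ ((y ∷ bl) ∷ bls)) e (_ ∷ ne) =
  subst (λ t → ((t ∷ []) ∷ (y ∷ bl) ∷ bls) ∈ cuts (a ∷ b ∷ w)) (sym (∷-injectiveˡ e))
    (∈-concatMap⁺ _ (lose (∈-cuts⁺ (b ∷ w) ((y ∷ bl) ∷ bls) (∷-injectiveʳ e) ne) (here refl)))
∈-cuts⁺ (a ∷ b ∷ w) ((x ∷ []) ∷ ([] ∷ bls)) e (_ ∷ () ∷ _)
∈-cuts⁺ (a ∷ b ∷ w) ((x ∷ y ∷ B) ∷ bls) e (_ ∷ ne) =
  subst (λ t → ((t ∷ y ∷ B) ∷ bls) ∈ cuts (a ∷ b ∷ w)) (sym (∷-injectiveˡ e))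
    (∈-concatMap⁺ _ (lose (∈-cuts⁺ (b ∷ w) ((y ∷ B) ∷ bls) (∷-injectiveʳ e) (z<s ∷ ne)) (there (here refl))))

cuts-unique : ∀ w → Unique (cuts w)
cuts-unique []          = [] ∷ []
cuts-unique (a ∷ [])    = [] ∷ []
cuts-unique (a ∷ b ∷ w) = unique-concatMap _ uncut (cuts-unique (b ∷ w)) unique-ext uncut-ext
  where
  uncut : Blocks → Blocks
  uncut ((_ ∷ []) ∷ rest)     = rest
  uncut ((_ ∷ c ∷ cs) ∷ rest) = (c ∷ cs) ∷ rest
  uncut _                     = []
  unique-ext : ∀ {bls} → bls ∈ cuts (b ∷ w) → Unique _
  unique-ext {[]}               _  = []
  unique-ext {[] ∷ bs}          c∈ with () ← All.head (proj₂ (∈-cuts⁻ (b ∷ w) c∈))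
  unique-ext {(c ∷ cs) ∷ bs}    _  = ((λ ()) ∷ []) ∷ [] ∷ []
  uncut-ext : ∀ {bls y} → bls ∈ cuts (b ∷ w) → y ∈ _ → uncut y ≡ bls
  uncut-ext {[] ∷ bs}          c∈ _ with () ← All.head (proj₂ (∈-cuts⁻ (b ∷ w) c∈))
  uncut-ext {(c ∷ cs) ∷ bs}    _  (here refl)         = refl
  uncut-ext {(c ∷ cs) ∷ bs}    _  (there (here refl)) = refl

listPartitions-unique : ∀ n → Unique (listPartitions n)
listPartitions-unique n = Unique.filter⁺ (λ x → T? (isListPartition n x))
  (unique-concatMap cuts concat (words-unique n n) (λ {w} _ → cuts-unique w) (λ {w} _ p → proj₁ (∈-cuts⁻ w p)))

∈-listPartitions⁻ : ∀ n {x} → x ∈ listPartitions n → IsListPartition n x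
∈-listPartitions⁻ n {x} p with ∈-filter⁻ (λ x → T? (isListPartition n x)) {xs = concatMap cuts (words n n)} p
... | q , t with find (∈-concatMap⁻ cuts {xs = words n n} q)
... | w , w∈ , x∈ with ∈-cuts⁻ w x∈ | ∈-words⁻ n n w∈
... | refl , ne | length≡n , entries = (ne , entries , length≡n) , isListPartition⇒ n x t

∈-listPartitions⁺ : ∀ n {x} → IsListPartition n x → x ∈ listPartitions n
∈-listPartitions⁺ n {x} ((ne , entries , length≡n) , covers , inc) =
  ∈-filter⁺ (λ x → T? (isListPartition n x))
    (∈-concatMap⁺ cuts (lose (∈-words⁺ n n length≡n entries) (∈-cuts⁺ (concat x) x refl ne)))
    (⇒isListPartition n x length≡n covers inc)

minL-∈ : ∀ a w → minL (a ∷ w) ∈ a ∷ w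
minL-∈ a []      = here refl
minL-∈ a (b ∷ w) with ⌊ a <? minL (b ∷ w) ⌋
... | true  = here refl
... | false = there (minL-∈ b w)

minL< : ∀ {N} B → NonEmpty B → All (_< N) B → minL B < N
minL< (a ∷ w) _ B<N = All.lookup B<N (minL-∈ a w)

minL-insertions : ∀ N a w → All (_< N) (a ∷ w) →
  All (λ B′ → minL B′ ≡ minL (a ∷ w)) (insertions N (a ∷ w))
minL-insertions N a [] (a<N ∷ []) =
  cong (if_then N else a) (⌊⌋-no (N <? a) (<-asym a<N)) ∷ cong (if_then a else N) (⌊⌋-yes (a <? N) a<N) ∷ []
minL-insertions N a (b ∷ w) (a<N ∷ bw<N) =
  cong (if_then N else minL (a ∷ b ∷ w)) (⌊⌋-no (N <? _) (<-asym (minL< (a ∷ b ∷ w) z<s (a<N ∷ bw<N))))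
  ∷ map⁺ (All.zipWith (λ { {[]} (() , _)
                         ; {c ∷ cs} (_ , e) → cong (λ m → if ⌊ a <? m ⌋ then a else m) e })
                      (nonEmpty-insertions N (b ∷ w) , minL-insertions N b w bw<N))

minima< : ∀ {n x} → Fits n x → All (_< suc n) (map minL x)
minima< fits@(ne , _) = map⁺ (All.zipWith (λ {B} (neB , B<) → minL< B neB B<) (ne , entries< fits))

increasing-∷ʳ : ∀ xs {N} → T (increasing xs) → All (_< N) xs → T (increasing (xs ++ N ∷ []))
increasing-∷ʳ []          _ _          = _
increasing-∷ʳ (a ∷ [])    {N} _ (a<N ∷ []) = Equivalence.from (T-∧ {⌊ a <? N ⌋}) (fromWitness a<N , _)
increasing-∷ʳ (a ∷ b ∷ w) inc (_ ∷ bw<N) = Equivalence.from (T-∧ {⌊ a <? b ⌋})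
  (proj₁ split , increasing-∷ʳ (b ∷ w) (proj₂ split) bw<N)
  where
  split = Equivalence.to (T-∧ {⌊ a <? b ⌋}) inc

increasing-∷ʳ⁻ : ∀ xs N → T (increasing (xs ++ N ∷ [])) → T (increasing xs)
increasing-∷ʳ⁻ []          N _   = _
increasing-∷ʳ⁻ (a ∷ [])    N _   = _
increasing-∷ʳ⁻ (a ∷ b ∷ w) N inc = Equivalence.from (T-∧ {⌊ a <? b ⌋})
  (proj₁ split , increasing-∷ʳ⁻ (b ∷ w) N (proj₂ split))
  where
  split = Equivalence.to (T-∧ {⌊ a <? b ⌋}) inc

increasing-adjacent : ∀ xs a b r → T (increasing (xs ++ a ∷ b ∷ r)) → a < b
increasing-adjacent []          a b r inc = toWitness (proj₁ (Equivalence.to (T-∧ {⌊ a <? b ⌋}) inc))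
increasing-adjacent (c ∷ [])    a b r inc =
  increasing-adjacent [] a b r (proj₂ (Equivalence.to (T-∧ {⌊ c <? a ⌋}) inc))
increasing-adjacent (c ∷ d ∷ xs) a b r inc =
  increasing-adjacent (d ∷ xs) a b r (proj₂ (Equivalence.to (T-∧ {⌊ c <? d ⌋}) inc))

insertIntoBlock-minL : ∀ N bs {y} → All NonEmpty bs → All (All (_< N)) bs →
  y ∈ insertIntoBlock N bs → map minL y ≡ map minL bs
insertIntoBlock-minL N (B ∷ bs) (neB ∷ ne) (B<N ∷ bs<N) p with ∈-++⁻ (map (_∷ bs) (insertions N B)) p
... | inj₂ q with ∈-map⁻ (B ∷_) q
...   | y′ , r , refl = cong (minL B ∷_) (insertIntoBlock-minL N bs ne bs<N r)
insertIntoBlock-minL N ((a ∷ w) ∷ bs) _ (B<N ∷ _) p | inj₁ q with ∈-map⁻ (_∷ bs) q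
...   | B′ , r , refl = cong (_∷ map minL bs) (All.lookup (minL-insertions N a w B<N) r)

isListPartition-extensions : ∀ n {x y} → IsListPartition n x → y ∈ extensions (suc n) x →
  IsListPartition (suc n) y
isListPartition-extensions n {x} {y} (fits , covers , inc) y∈ =
  fits-extensions n fits y∈ , covers′ , increasing′
  where
  perm = extensions-↭ (suc n) x y∈
  covers′ : Covers (suc n) (concat y)
  covers′ i i≤n with i ≟ n
  ... | yes refl = ∈-resp-↭ (↭-sym perm) (here refl)
  ... | no i≢n  = ∈-resp-↭ (↭-sym perm) (there (covers i (≤∧≢⇒< (≤-pred i≤n) i≢n)))
  increasing′ : T (increasing (map minL y))
  increasing′ with ∈-++⁻ (insertIntoBlock (suc n) x) y∈
  ... | inj₁ q          =
    subst (T ∘ increasing) (sym (insertIntoBlock-minL (suc n) x (proj₁ fits) (entries< fits) q)) inc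
  ... | inj₂ (here refl) = subst (T ∘ increasing) (sym (map-++ minL x ((suc n ∷ []) ∷ [])))
                                 (increasing-∷ʳ (map minL x) inc (minima< fits))

length-insert : ∀ N (w₁ w₂ : List ℕ) → length (w₁ ++ N ∷ w₂) ≡ suc (length (w₁ ++ w₂))
length-insert N w₁ w₂ =
  trans (length-++ w₁) (trans (+-suc (length w₁) (length w₂)) (cong suc (sym (length-++ w₁))))

∈-remove : ∀ {N e} (w₁ w₂ : List ℕ) → e ∈ w₁ ++ N ∷ w₂ → e ≢ N → e ∈ w₁ ++ w₂
∈-remove w₁ w₂ p e≢N with ∈-++⁻ w₁ p
... | inj₁ q         = ∈-++⁺ˡ q
... | inj₂ (here e≡N) = contradiction e≡N e≢N
... | inj₂ (there q)  = ∈-++⁺ʳ w₁ q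

∈-insert : ∀ {N e} (w₁ w₂ : List ℕ) → e ∈ w₁ ++ w₂ → e ∈ w₁ ++ N ∷ w₂
∈-insert w₁ w₂ p with ∈-++⁻ w₁ p
... | inj₁ q = ∈-++⁺ˡ q
... | inj₂ q = ∈-++⁺ʳ w₁ (there q)

covers⇒≤length : ∀ n w → Covers n w → n ≤ length w
covers⇒≤length zero    w _      = z≤n
covers⇒≤length (suc n) w covers with ∈-∃++ (covers n ≤-refl)
... | w₁ , w₂ , refl = subst (suc n ≤_) (sym (length-insert (suc n) w₁ w₂)) (s≤s
  (covers⇒≤length n (w₁ ++ w₂) λ i i<n →
     ∈-remove w₁ w₂ (covers i (m≤n⇒m≤1+n i<n)) λ e → <-irrefl (suc-injective e) i<n))

insertions-middle : ∀ N B₁ B₂ → B₁ ++ N ∷ B₂ ∈ insertions N (B₁ ++ B₂)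
insertions-middle N []       []      = here refl
insertions-middle N []       (b ∷ B₂) = here refl
insertions-middle N (a ∷ B₁) B₂      = there (∈-map⁺ (a ∷_) (insertions-middle N B₁ B₂))

insertIntoBlock-middle : ∀ N (pre : Blocks) B B′ post → B′ ∈ insertions N B →
  pre ++ B′ ∷ post ∈ insertIntoBlock N (pre ++ B ∷ post)
insertIntoBlock-middle N []        B B′ post p = ∈-++⁺ˡ (∈-map⁺ (_∷ post) p)
insertIntoBlock-middle N (C ∷ pre) B B′ post p = ∈-++⁺ʳ (map (_∷ (pre ++ B ∷ post)) (insertions N C))
  (∈-map⁺ (C ∷_) (insertIntoBlock-middle N pre B B′ post p))

-- Removing n + 1 from π, where it sits between B₁ and B₂ in the list following the lists pre.
module Restrict (n : ℕ) (pre : Blocks) (B₁ B₂ : List ℕ) (post : Blocks)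
                (P : IsListPartition (suc n) (pre ++ (B₁ ++ suc n ∷ B₂) ∷ post)) where

  N : ℕ
  N = suc n

  π : Blocks
  π = pre ++ (B₁ ++ N ∷ B₂) ∷ post

  w₁ w₂ : List ℕ
  w₁ = concat pre ++ B₁
  w₂ = B₂ ++ concat post

  concat-π : concat π ≡ w₁ ++ N ∷ w₂
  concat-π = trans (sym (concat-++ pre ((B₁ ++ N ∷ B₂) ∷ post)))
                   (trans (cong (concat pre ++_) (++-assoc B₁ (N ∷ B₂) (concat post)))
                          (sym (++-assoc (concat pre) B₁ (N ∷ w₂))))

  length-rest : length (w₁ ++ w₂) ≡ n
  length-rest = suc-injective (trans (sym (length-insert N w₁ w₂))
                                     (trans (cong length (sym concat-π)) (proj₂ (proj₂ (proj₁ P)))))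

  covers-rest : Covers n (w₁ ++ w₂)
  covers-rest i i<n = ∈-remove w₁ w₂ (subst (suc i ∈_) concat-π (proj₁ (proj₂ P) i (m≤n⇒m≤1+n i<n)))
                                     λ e → <-irrefl (suc-injective e) i<n

  N∉rest : N ∉ w₁ ++ w₂
  N∉rest N∈ = <-irrefl refl (subst (N ≤_) length-rest (covers⇒≤length N (w₁ ++ w₂) covers))
    where
    covers : Covers N (w₁ ++ w₂)
    covers i i≤n with i ≟ n
    ... | yes refl = N∈
    ... | no i≢n  = covers-rest i (≤∧≢⇒< (≤-pred i≤n) i≢n)

  entries-rest : All (InRange n) (w₁ ++ w₂)
  entries-rest = All.tabulate λ {e} e∈ →
    let (0<e , e≤N) = All.lookup entries (∈-insert w₁ w₂ e∈)
    in 0<e , ≤-pred (≤∧≢⇒< e≤N λ e≡N → N∉rest (subst (_∈ w₁ ++ w₂) e≡N e∈))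
    where
    entries = subst (All (InRange N)) concat-π (proj₁ (proj₂ (proj₁ P)))

  nonEmpty-pre : All NonEmpty pre
  nonEmpty-pre = ++⁻ˡ pre (proj₁ (proj₁ P))

  nonEmpty-post : All NonEmpty post
  nonEmpty-post = All.tail (++⁻ʳ pre (proj₁ (proj₁ P)))

  -- A later list would have a minimum above n + 1.
  alone : B₁ ≡ [] → B₂ ≡ [] → ∃ λ ξ → IsListPartition n ξ × π ∈ extensions N ξ
  alone refl refl = by-post post refl
    where
    increasing-π : T (increasing (map minL pre ++ map minL ((N ∷ []) ∷ post)))
    increasing-π = subst (T ∘ increasing) (map-++ minL pre ((N ∷ []) ∷ post)) (proj₂ (proj₂ P))
    by-post : ∀ post′ → post′ ≡ post → ∃ λ ξ → IsListPartition n ξ × π ∈ extensions N ξ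
    by-post [] refl =
      pre , ((nonEmpty-pre , subst (All (InRange n)) (sym concat-pre) entries-rest ,
              trans (cong length concat-pre) length-rest) ,
             subst (Covers n) (sym concat-pre) covers-rest ,
             increasing-∷ʳ⁻ (map minL pre) N increasing-π) ,
      ∈-++⁺ʳ (insertIntoBlock N pre) (here refl)
      where
      concat-pre : concat pre ≡ w₁ ++ w₂
      concat-pre = sym (trans (++-identityʳ _) (++-identityʳ _))
    by-post (C ∷ post′) refl = contradiction N<minL (<⇒≱ (minL< C neC C<N))
      where
      C∈ : C ∈ π
      C∈ = ∈-++⁺ʳ pre (there (here refl))
      neC = All.lookup (proj₁ (proj₁ P)) C∈
      C<N = All.lookup (entries< (proj₁ P)) C∈
      N<minL : N < minL C
      N<minL = increasing-adjacent (map minL pre) N (minL C) (map minL post′) increasing-π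

  shared : ∀ a w → B₁ ++ B₂ ≡ a ∷ w → ∃ λ ξ → IsListPartition n ξ × π ∈ extensions N ξ
  shared a w B₁++B₂≡ = ξ , ((nonEmpty-ξ , subst (All (InRange n)) (sym concat-ξ) entries-rest ,
                            trans (cong length concat-ξ) length-rest) ,
                           subst (Covers n) (sym concat-ξ) covers-rest ,
                           subst (T ∘ increasing) minima-ξ (proj₂ (proj₂ P))) ,
                      ∈-++⁺ˡ (insertIntoBlock-middle N pre (B₁ ++ B₂) (B₁ ++ N ∷ B₂) post
                                                     (insertions-middle N B₁ B₂))
    where
    ξ : Blocks
    ξ = pre ++ (B₁ ++ B₂) ∷ post
    nonEmpty-ξ : All NonEmpty ξ
    nonEmpty-ξ = ++⁺ nonEmpty-pre (subst NonEmpty (sym B₁++B₂≡) z<s ∷ nonEmpty-post)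
    concat-ξ : concat ξ ≡ w₁ ++ w₂
    concat-ξ = trans (sym (concat-++ pre ((B₁ ++ B₂) ∷ post)))
                     (trans (cong (concat pre ++_) (++-assoc B₁ B₂ (concat post)))
                            (sym (++-assoc (concat pre) B₁ w₂)))
    B⊆rest : ∀ {e} → e ∈ B₁ ++ B₂ → e ∈ w₁ ++ w₂
    B⊆rest p with ∈-++⁻ B₁ p
    ... | inj₁ q = ∈-++⁺ˡ (∈-++⁺ʳ (concat pre) q)
    ... | inj₂ q = ∈-++⁺ʳ w₁ (∈-++⁺ˡ q)
    B<N : All (_< N) (a ∷ w)
    B<N = All.tabulate λ {e} p → s≤s (proj₂ (All.lookup entries-rest (B⊆rest (subst (e ∈_) (sym B₁++B₂≡) p))))
    minL-B : minL (B₁ ++ N ∷ B₂) ≡ minL (B₁ ++ B₂)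
    minL-B = trans (All.lookup (minL-insertions N a w B<N)
                               (subst (λ t → B₁ ++ N ∷ B₂ ∈ insertions N t) B₁++B₂≡ (insertions-middle N B₁ B₂)))
                   (cong minL (sym B₁++B₂≡))
    minima-ξ : map minL π ≡ map minL ξ
    minima-ξ = trans (map-++ minL pre ((B₁ ++ N ∷ B₂) ∷ post))
               (trans (cong (λ t → map minL pre ++ t ∷ map minL post) minL-B)
                      (sym (map-++ minL pre ((B₁ ++ B₂) ∷ post))))

isListPartition-restrict : ∀ n {y} → IsListPartition (suc n) y →
  ∃ λ x → IsListPartition n x × y ∈ extensions (suc n) x
isListPartition-restrict n {y} P with ∈-concat⁻′ y (proj₁ (proj₂ P) n ≤-refl)
... | B , N∈B , B∈y with ∈-∃++ B∈y | ∈-∃++ N∈B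
... | pre , post , refl | []     , []     , refl = Restrict.alone n pre [] [] post P refl refl
... | pre , post , refl | []     , b ∷ B₂ , refl = Restrict.shared n pre [] (b ∷ B₂) post P b B₂ refl
... | pre , post , refl | a ∷ B₁ , B₂     , refl = Restrict.shared n pre (a ∷ B₁) B₂ post P a (B₁ ++ B₂) refl

∈-byInsertion⁻ : ∀ n {x} → x ∈ byInsertion n → IsListPartition n x
∈-byInsertion⁻ zero    (here refl) = ([] , [] , refl) , (λ _ ()) , _
∈-byInsertion⁻ (suc n) x∈ with find (∈-concatMap⁻ (extensions (suc n)) {xs = byInsertion n} x∈)
... | x′ , x′∈ , x∈ext = isListPartition-extensions n (∈-byInsertion⁻ n x′∈) x∈ext

∈-byInsertion⁺ : ∀ n {x} → IsListPartition n x → x ∈ byInsertion n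
∈-byInsertion⁺ zero    {[]}            _                     = here refl
∈-byInsertion⁺ zero    {[] ∷ x}        ((() ∷ _ , _) , _)
∈-byInsertion⁺ zero    {(e ∷ B) ∷ x}   ((_ , _ , ()) , _)
∈-byInsertion⁺ (suc n) P with isListPartition-restrict n P
... | x′ , P′ , x∈ext = ∈-concatMap⁺ (extensions (suc n)) (lose (∈-byInsertion⁺ n P′) x∈ext)

without : ℕ → List ℕ → List ℕ
without N []      = []
without N (e ∷ w) with e ≟ N
... | yes _ = without N w
... | no  _ = e ∷ without N w

consNonEmpty : List ℕ → Blocks → Blocks
consNonEmpty []      bs = bs
consNonEmpty (e ∷ w) bs = (e ∷ w) ∷ bs

remove : ℕ → Blocks → Blocks
remove N []       = []
remove N (B ∷ bs) = consNonEmpty (without N B) (remove N bs)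

consNonEmpty-cong : ∀ B {bs bs′} → NonEmpty B → bs′ ≡ bs → consNonEmpty B bs′ ≡ B ∷ bs
consNonEmpty-cong (e ∷ B) _ = cong ((e ∷ B) ∷_)

without-∉ : ∀ N w → N ∉ w → without N w ≡ w
without-∉ N []      _  = refl
without-∉ N (e ∷ w) N∉ with e ≟ N
... | yes refl = contradiction (here refl) N∉
... | no  _    = cong (e ∷_) (without-∉ N w (N∉ ∘ there))

without-insertions : ∀ N w {B′} → N ∉ w → B′ ∈ insertions N w → without N B′ ≡ w
without-insertions N []      N∉ (here refl) with N ≟ N
... | yes _   = refl
... | no  N≢N = contradiction refl N≢N
without-insertions N (a ∷ w) N∉ (here refl) with N ≟ N
... | yes _   = without-∉ N (a ∷ w) N∉
... | no  N≢N = contradiction refl N≢N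
without-insertions N (a ∷ w) N∉ (there p) with ∈-map⁻ (a ∷_) p
... | B′ , q , refl with a ≟ N
...   | yes refl = contradiction (here refl) N∉
...   | no  _    = cong (a ∷_) (without-insertions N w (N∉ ∘ there) q)

remove-∉ : ∀ N bs → All NonEmpty bs → N ∉ concat bs → remove N bs ≡ bs
remove-∉ N []       _          _  = refl
remove-∉ N (B ∷ bs) (neB ∷ ne) N∉ rewrite without-∉ N B (N∉ ∘ ∈-++⁺ˡ) =
  consNonEmpty-cong B neB (remove-∉ N bs ne (N∉ ∘ ∈-++⁺ʳ B))

remove-extensions : ∀ N bs {π} → All NonEmpty bs → N ∉ concat bs → π ∈ extensions N bs → remove N π ≡ bs
remove-extensions N bs ne N∉ p with ∈-++⁻ (insertIntoBlock N bs) p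
... | inj₁ q          = remove-insertIntoBlock bs ne N∉ q
  where
  remove-insertIntoBlock : ∀ bs {π} → All NonEmpty bs → N ∉ concat bs → π ∈ insertIntoBlock N bs →
    remove N π ≡ bs
  remove-insertIntoBlock (B ∷ bs) (neB ∷ ne) N∉ p with ∈-++⁻ (map (_∷ bs) (insertions N B)) p
  ... | inj₁ q with ∈-map⁻ (_∷ bs) q
  ...   | B′ , r , refl rewrite without-insertions N B (N∉ ∘ ∈-++⁺ˡ) r =
    consNonEmpty-cong B neB (remove-∉ N bs ne (N∉ ∘ ∈-++⁺ʳ B))
  remove-insertIntoBlock (B ∷ bs) (neB ∷ ne) N∉ p | inj₂ q with ∈-map⁻ (B ∷_) q
  ...   | π′ , r , refl rewrite without-∉ N B (N∉ ∘ ∈-++⁺ˡ) =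
    consNonEmpty-cong B neB (remove-insertIntoBlock bs ne (N∉ ∘ ∈-++⁺ʳ B) r)
... | inj₂ (here refl) = remove-new bs ne N∉
  where
  remove-new : ∀ bs → All NonEmpty bs → N ∉ concat bs → remove N (bs ++ (N ∷ []) ∷ []) ≡ bs
  remove-new [] _ _ with N ≟ N
  ... | yes _   = refl
  ... | no  N≢N = contradiction refl N≢N
  remove-new (B ∷ bs) (neB ∷ ne) N∉ rewrite without-∉ N B (N∉ ∘ ∈-++⁺ˡ) =
    consNonEmpty-cong B neB (remove-new bs ne (N∉ ∘ ∈-++⁺ʳ B))

insertions-unique : ∀ N w → N ∉ w → Unique (insertions N w)
insertions-unique N []      _  = [] ∷ []
insertions-unique N (a ∷ w) N∉ =
  All.tabulate distinct ∷ Unique.map⁺ ∷-injectiveʳ (insertions-unique N w (N∉ ∘ there))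
  where
  distinct : ∀ {v} → v ∈ map (a ∷_) (insertions N w) → N ∷ a ∷ w ≢ v
  distinct v∈ e with ∈-map⁻ (a ∷_) v∈
  ... | _ , _ , refl = N∉ (here (∷-injectiveˡ e))

insertIntoBlock-unique : ∀ N bs → N ∉ concat bs → Unique (insertIntoBlock N bs)
insertIntoBlock-unique N []       _  = []
insertIntoBlock-unique N (B ∷ bs) N∉ = Unique.++⁺
  (Unique.map⁺ ∷-injectiveˡ (insertions-unique N B (N∉ ∘ ∈-++⁺ˡ)))
  (Unique.map⁺ ∷-injectiveʳ (insertIntoBlock-unique N bs (N∉ ∘ ∈-++⁺ʳ B)))
  disjoint
  where
  disjoint : ∀ {v} → v ∈ map (_∷ bs) (insertions N B) × v ∈ map (B ∷_) (insertIntoBlock N bs) → ⊥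
  disjoint (p , q) with ∈-map⁻ (_∷ bs) p | ∈-map⁻ (B ∷_) q
  ... | B′ , r , refl | _ , _ , e =
    N∉ (∈-++⁺ˡ (subst (N ∈_) (∷-injectiveˡ e) (∈-resp-↭ (↭-sym (insertions-↭ N B r)) (here refl))))

extensions-unique : ∀ N bs → N ∉ concat bs → Unique (extensions N bs)
extensions-unique N bs N∉ = Unique.++⁺ (insertIntoBlock-unique N bs N∉) ([] ∷ []) disjoint
  where
  disjoint : ∀ {v} → v ∈ insertIntoBlock N bs × v ∈ (bs ++ (N ∷ []) ∷ []) ∷ [] → ⊥
  disjoint (p , here refl) = 1+n≢n (trans (trans (+-comm 1 (length bs)) (sym (length-++ bs)))
                                          (All.lookup (length-insertIntoBlock N bs) p))

suc∉fits : ∀ {n x} → Fits n x → suc n ∉ concat x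
suc∉fits (_ , entries , _) p = <-irrefl refl (proj₂ (All.lookup entries p))

byInsertion-unique : ∀ n → Unique (byInsertion n)
byInsertion-unique zero    = [] ∷ []
byInsertion-unique (suc n) =
  unique-concatMap (extensions (suc n)) (remove (suc n)) (byInsertion-unique n)
    (λ {x} x∈ → extensions-unique (suc n) x (suc∉fits (fits x∈)))
    (λ {x} x∈ π∈ → remove-extensions (suc n) x (proj₁ (fits x∈)) (suc∉fits (fits x∈)) π∈)
  where
  fits : ∀ {x} → x ∈ byInsertion n → Fits n x
  fits = proj₁ ∘ ∈-byInsertion⁻ n

ind-∧ : ∀ β γ → ind (β ∧ γ) ≡ ind β * ind γ
ind-∧ true  γ = sym (+-identityʳ (ind γ))
ind-∧ false γ = refl

ind-≟ : ∀ u v → ind ⌊ u ≟ v ⌋ ≡ 𝟙[ u ≡ v ]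
ind-≟ u v = cong ind (isYes≗does (u ≟ v))

C≡Σ : ∀ n k m → C n k m ≡ Σₗ (byInsertion n) λ π → 𝟙[ length π ≡ k ] * 𝟙[ asc π ≡ m ]
C≡Σ n k m = begin
  C n k m
    ≡⟨ length-filterᵇ p (listPartitions n) ⟩
  Σₗ (listPartitions n) (ind ∘ p)
    ≡⟨ Σₗ-unique-⇔ (listPartitions-unique n) (byInsertion-unique n) same-members (ind ∘ p) ⟩
  Σₗ (byInsertion n) (ind ∘ p)
    ≡⟨ Σₗ-cong′ (byInsertion n) (λ π → trans (ind-∧ ⌊ length π ≟ k ⌋ ⌊ asc π ≟ m ⌋)
                                            (cong₂ _*_ (ind-≟ (length π) k) (ind-≟ (asc π) m))) ⟩
  Σₗ (byInsertion n) (λ π → 𝟙[ length π ≡ k ] * 𝟙[ asc π ≡ m ]) ∎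
  where
  p : Blocks → Bool
  p π = ⌊ length π ≟ k ⌋ ∧ ⌊ asc π ≟ m ⌋
  same-members : ∀ {π} → π ∈ listPartitions n ⇔ π ∈ byInsertion n
  same-members = mk⇔ (∈-byInsertion⁺ n ∘ ∈-listPartitions⁻ n) (∈-listPartitions⁺ n ∘ ∈-byInsertion⁻ n)

gen : ℕ → Coeffs
gen n a b c = Σₗ (byInsertion n) λ π → monomial (asc π) (length π + n ∸ asc π) 1 a b c

δ-gen : ∀ n → δ (gen n) ≗₃ gen (suc n)
δ-gen n = linear-Σₗ (IsDerivation.linear δ-derivation) (byInsertion n) F ∙ λ a b c →
  trans (Σₗ-cong (byInsertion n) (All.tabulate λ π∈ → step a b c (proj₁ (∈-byInsertion⁻ n π∈))))
        (sym (Σₗ-concatMap (extensions (suc n)) (byInsertion n) λ ρ → G ρ a b c))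
  where
  F G : Blocks → Coeffs
  F π = monomial (asc π) (length π + n ∸ asc π) 1
  G ρ = monomial (asc ρ) (length ρ + suc n ∸ asc ρ) 1
  step : ∀ a b c {π} → Fits n π → δ (F π) a b c ≡ Σₗ (extensions (suc n) π) λ ρ → G ρ a b c
  step a b c {π} fits = trans (δ-monomial m e 1 a b c) (sym (begin
    Σₗ (extensions (suc n) π) (λ ρ → G ρ a b c)
      ≡⟨ extensions-count n π fits (λ α κ → M α (κ + suc n ∸ α)) ⟩
    m * M m (k + suc n ∸ m) + e * M (suc m) (k + suc n ∸ suc m) + M (suc m) (k + suc n ∸ m)
      ≡⟨ cong₂ (λ u v → m * M m u + e * M (suc m) v + M (suc m) u) raised kept ⟩
    m * M m (suc e) + e * M (suc m) e + M (suc m) (suc e)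
      ≡⟨ cong (m * M m (suc e) + e * M (suc m) e +_) (*-identityˡ _) ⟨
    m * M m (suc e) + e * M (suc m) e + 1 * M (suc m) (suc e) ∎))
    where
    m = asc π
    k = length π
    e = k + n ∸ m
    M : ℕ → ℕ → ℕ
    M u v = monomial u v 1 a b c
    m≤k+n : m ≤ k + n
    m≤k+n = ≤-trans (asc≤size π) (subst (_≤ k + n) (sym (size-fits fits)) (m≤n+m n k))
    raised : k + suc n ∸ m ≡ suc e
    raised = trans (cong (_∸ m) (+-suc k n)) (+-∸-assoc 1 m≤k+n)
    kept : k + suc n ∸ suc m ≡ e
    kept = cong (_∸ suc m) (+-suc k n)

coeff-D^z : ∀ n → coeff (D^ n z) ≗₃ gen n
coeff-D^z zero    = coeff-z ∙ λ _ _ _ → sym (+-identityʳ _)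
coeff-D^z (suc n) = coeff-D (D^ n z) ∙ δ-cong (coeff-D^z n) ∙ δ-gen n

length≤asc : ∀ bs → All NonEmpty bs → All (0 <_) (concat bs) → length bs ≤ asc bs
length≤asc []             _        _           = z≤n
length≤asc ([] ∷ bs)      (() ∷ _) _
length≤asc ((e ∷ w) ∷ bs) (_ ∷ ne) (0<e ∷ pos) rewrite ⌊⌋-yes (0 <? e) 0<e =
  s≤s (≤-trans (length≤asc bs ne (++⁻ʳ w pos)) (m≤n+m (asc bs) (ascFrom e w)))

fits-bounds : ∀ n {π} → Fits (suc n) π → 1 ≤ length π × length π ≤ asc π × asc π ≤ suc n
fits-bounds n {[]}    (_ , _ , ())
fits-bounds n {B ∷ π} fits@(ne , entries , _) =
  z<s , length≤asc (B ∷ π) ne (All.map proj₁ entries) ,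
  subst (asc (B ∷ π) ≤_) (size-fits fits) (asc≤size (B ∷ π))

coeff-ΣP : ∀ lo hi (f : ℕ → Poly) a b c →
  coeff (ΣP lo hi f) a b c ≡ Σ< (suc hi ∸ lo) (λ i → coeff (f (lo + i)) a b c)
coeff-ΣP lo hi f a b c = trans (coeff-foldr (upTo (suc hi ∸ lo))) (Σₗ-upTo (suc hi ∸ lo) _)
  where
  coeff-foldr : ∀ is → coeff (foldr _⊕_ (const 0) (map (λ i → f (lo + i)) is)) a b c
                       ≡ Σₗ is (λ i → coeff (f (lo + i)) a b c)
  coeff-foldr []       = refl
  coeff-foldr (i ∷ is) = cong (coeff (f (lo + i)) a b c +_) (coeff-foldr is)

coeff-rhs : ∀ n → 1 ≤ n →
  coeff (ΣP 1 n λ k → ΣP k n λ m → const (C n k m) ⊗ (x ^ₚ m) ⊗ (y ^ₚ (k + n ∸ m)) ⊗ z) ≗₃ gen n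
coeff-rhs n@(suc n′) _ a b c = begin
  coeff (ΣP 1 n Ψ) a b c
    ≡⟨ coeff-ΣP 1 n Ψ a b c ⟩
  Σ< n (λ i → coeff (Ψ (suc i)) a b c)
    ≡⟨ Σ<-cong′ n (λ i → trans (coeff-ΣP (suc i) n (ψ (suc i)) a b c) (Σ<-cong′ (n ∸ i) (term i))) ⟩
  Σ< n (λ i → Σ< (n ∸ i) λ j → Σₗ (byInsertion n) (h i j))
    ≡⟨ trans (Σ<-cong′ n λ i → Σ<-Σₗ (n ∸ i) (byInsertion n) (h i))
             (Σ<-Σₗ n (byInsertion n) λ i π → Σ< (n ∸ i) λ j → h i j π) ⟩
  Σₗ (byInsertion n) (λ π → Σ< n λ i → Σ< (n ∸ i) λ j → h i j π)
    ≡⟨ Σₗ-cong (byInsertion n) (All.tabulate pick) ⟩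
  gen n a b c ∎
  where
  ψ : ℕ → ℕ → Poly
  ψ k m = const (C n k m) ⊗ (x ^ₚ m) ⊗ (y ^ₚ (k + n ∸ m)) ⊗ z
  Ψ : ℕ → Poly
  Ψ k = ΣP k n (ψ k)
  M : ℕ → ℕ → ℕ
  M k m = monomial m (k + n ∸ m) 1 a b c
  h : ℕ → ℕ → Blocks → ℕ
  h i j π = 𝟙[ length π ≡ suc i ] * 𝟙[ asc π ≡ suc i + j ] * M (suc i) (suc i + j)
  term : ∀ i j → coeff (ψ (suc i) (suc i + j)) a b c ≡ Σₗ (byInsertion n) (h i j)
  term i j = trans (coeff-term (C n (suc i) (suc i + j)) (suc i + j) (suc i + n ∸ (suc i + j)) a b c)
                   (trans (cong (_* M (suc i) (suc i + j)) (C≡Σ n (suc i) (suc i + j)))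
                          (Σₗ-*ʳ (byInsertion n) (λ π → 𝟙[ length π ≡ suc i ] * 𝟙[ asc π ≡ suc i + j ])
                                 (M (suc i) (suc i + j))))
  pick : ∀ {π} → π ∈ byInsertion n → Σ< n (λ i → Σ< (n ∸ i) λ j → h i j π) ≡ M (length π) (asc π)
  pick π∈ with fits-bounds n′ (proj₁ (∈-byInsertion⁻ n π∈))
  ... | 1≤k , k≤m , m≤n = Σ<-triangle-single n M 1≤k k≤m m≤n

theorem2p4 : (n : ℕ) → 1 ≤ n →
    D^ n z ≈ₚ
      ΣP 1 n (λ k → ΣP k n (λ m → const (C n k m) ⊗ (x ^ₚ m) ⊗ (y ^ₚ (k + n ∸ m)) ⊗ z))
theorem2p4 n 1≤n = coeff-D^z n ∙ ≗₃-sym (coeff-rhs n 1≤n)
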